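{- Let $n\ge1$ and $m\ge0$ be integers. Then \[ \sum_{j=0}^{n}(-1)^j\,|\mathcal{C}_{n-j}^{j}(m)|=\sum_{j=0}^{n}(-1)^j\,|\mathcal{C}_{n-j}^{j}(m,*,|m+j)|. \]
   Context: Blue and red are two distinct colours. For integers $m,k,n\ge0$, the blue ground set is $K=\{m+1,\dots,m+k\}\cup\{*_b\}$ and the red ground set is $N=\{m+1,\dots,m+n\}\cup\{*_r\}$. A (shifted) Callan sequence of size $k\times n$ is a sequence of pairs $(B_1,R_1)\cdots(B_r,R_r)(B^*,R^*)$, $r\ge0$, such that $\{B_1,\dots,B_r,B^*\}$ is a set partition of $K$ into $r+1$ nonempty blocks with $*_b\in B^*$, and $\{R_1,\dots,R_r,R^*\}$ is a set partition of $N$ into $r+1$ nonempty blocks with $*_r\in R^*$; $(B_i,R_i)$ are ordinary pairs, $(B^*,R^*)$ is the extra pair. An $m$-barred Callan sequence of size $k\times n$ is a linear arrangement of $m$ blue bars labelled $1,\dots,m$, $m+1$ red bars labelled $0,\dots,m$, and the pairs of a shifted Callan sequence of size $k\times n$ in the order of that Callan sequence, such that every blue bar with label $i$ is immediately followed by a bar with label strictly smaller than $i$, and every red bar with label $i$ is immediately followed either by a Callan pair or by a bar with label strictly greater than $i$. $\mathcal{C}_n^k(m)$ is the set of these. $\mathcal{C}_n^k(m,*)$ is the subset of $\mathcal{C}_n^k(m)$ where the extra red block is $R^*=\{*_r\}$. For $k\ge1$, $\mathcal{C}_n^k(m,*,|m+k)$ is the subset of $\mathcal{C}_n^k(m,*)$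 of sequences in which the maximal blue element $m+k$ forms by itself the blue block of an ordinary pair, and this pair is immediately preceded by at least one bar; for $k=0$ this set is empty by convention. -}

module Defs where

open import Data.Nat using (ℕ; zero; suc; _+_; _∸_; _<ᵇ_; _≡ᵇ_)
open import Data.Bool using (Bool; true; false; _∧_; _∨_; not; if_then_else_)
open import Data.Fin using (Fin; toℕ; fromℕ; inject₁)
open import Data.Fin.Properties using (_≟_)
open import Data.Vec using (Vec; lookup; []; _∷_)
open import Data.List using (List; []; _∷_; map; concatMap; allFin; upTo; _++_)
open import Data.Product using (Σ; _×_; _,_)
open import Data.Integer using (ℤ; +_; -1ℤ; _^_) renaming (_+_ to _+ℤ_; _*_ to _*ℤ_)
open import Relation.Nullary.Decidable using (⌊_⌋)

countᵇ : {A : Set} → (A → Bool) → List A → ℕ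
countᵇ p [] = 0
countᵇ p (x ∷ xs) = if p x then suc (countᵇ p xs) else countᵇ p xs

allᵇ : {A : Set} → (A → Bool) → List A → Bool
allᵇ p [] = true
allᵇ p (x ∷ xs) = p x ∧ allᵇ p xs

anyᵇ : {A : Set} → (A → Bool) → List A → Bool
anyᵇ p [] = false
anyᵇ p (x ∷ xs) = p x ∨ anyᵇ p xs

allVecs : {A : Set} → List A → (k : ℕ) → List (Vec A k)
allVecs xs zero = [] ∷ []
allVecs xs (suc k) = concatMap (λ x → map (x ∷_) (allVecs xs k)) xs

allWords : {A : Set} → List A → ℕ → List (List A)
allWords xs zero = [] ∷ []
allWords xs (suc L) = concatMap (λ x → map (x ∷_) (allWords xs L)) xs

sumℕ : List ℕ → ℕ
sumℕ [] = 0
sumℕ (x ∷ xs) = x + sumℕ xs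

_==F_ : {r : ℕ} → Fin r → Fin r → Bool
i ==F j = ⌊ i ≟ j ⌋

-- Tokens of a barred arrangement.
--   pair    : a Callan pair (pairs appear in the order of the Callan sequence,
--             the last pair token being the extra pair (B*,R*))
--   bbar i  : the blue bar with label  toℕ i + 1   (labels 1..m)
--   rbar i  : the red bar with label   toℕ i       (labels 0..m)

data Token (m : ℕ) : Set where
  pair : Token m
  bbar : Fin m → Token m
  rbar : Fin (suc m) → Token m

allTokens : (m : ℕ) → List (Token m)
allTokens m = pair ∷ (map bbar (allFin m) ++ map rbar (allFin (suc m)))

blabel : {m : ℕ} → Fin m → ℕ
blabel i = suc (toℕ i)

rlabel : {m : ℕ} → Fin (suc m) → ℕ
rlabel i = toℕ i

isPair : {m : ℕ} → Token m → Bool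
isPair pair = true
isPair (bbar _) = false
isPair (rbar _) = false

isBBar : {m : ℕ} → Fin m → Token m → Bool
isBBar i (bbar j) = i ==F j
isBBar i _ = false

isRBar : {m : ℕ} → Fin (suc m) → Token m → Bool
isRBar i (rbar j) = i ==F j
isRBar i _ = false

blueFollowOK : {m : ℕ} → ℕ → List (Token m) → Bool
blueFollowOK ℓ [] = false
blueFollowOK ℓ (pair ∷ _) = false
blueFollowOK ℓ (bbar j ∷ _) = blabel j <ᵇ ℓ
blueFollowOK ℓ (rbar j ∷ _) = rlabel j <ᵇ ℓ

redFollowOK : {m : ℕ} → ℕ → List (Token m) → Bool
redFollowOK ℓ [] = false
redFollowOK ℓ (pair ∷ _) = true
redFollowOK ℓ (bbar j ∷ _) = ℓ <ᵇ blabel j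
redFollowOK ℓ (rbar j ∷ _) = ℓ <ᵇ rlabel j

adjacencyOK : {m : ℕ} → List (Token m) → Bool
adjacencyOK [] = true
adjacencyOK (pair ∷ w) = adjacencyOK w
adjacencyOK (bbar i ∷ w) = blueFollowOK (blabel i) w ∧ adjacencyOK w
adjacencyOK (rbar i ∷ w) = redFollowOK (rlabel i) w ∧ adjacencyOK w

arrangementOK : (m r : ℕ) → List (Token m) → Bool
arrangementOK m r w =
  (countᵇ isPair w ≡ᵇ suc r)
  ∧ allᵇ (λ i → countᵇ (isBBar i) w ≡ᵇ 1) (allFin m)
  ∧ allᵇ (λ i → countᵇ (isRBar i) w ≡ᵇ 1) (allFin (suc m))
  ∧ adjacencyOK w

-- Blue element x : Fin k stands for m+1+toℕ x; *_b is not represented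
-- (it always lies in B*).  Similarly red y : Fin n stands for m+1+toℕ y.
-- f x = index of the pair containing x: inject₁ b (b : Fin r) for the ordinary
-- pair number b+1, and fromℕ r for the extra pair.  The partitions are
-- B_{b+1} = f⁻¹(b), B* = {*_b} ∪ f⁻¹(r) etc.; the condition is that every
-- ordinary block is nonempty.

callanOK : (k n r : ℕ) → Vec (Fin (suc r)) k → Vec (Fin (suc r)) n → Bool
callanOK k n r f g =
  allᵇ (λ b → anyᵇ (λ x → lookup f x ==F inject₁ b) (allFin k)
            ∧ anyᵇ (λ y → lookup g y ==F inject₁ b) (allFin n)) (allFin r)

BarredCallan : (m k n r : ℕ) → Set
BarredCallan m k n r = Vec (Fin (suc r)) k × Vec (Fin (suc r)) n × List (Token m)

barredOK : (m k n r : ℕ) → BarredCallan m k n r → Bool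
barredOK m k n r (f , g , w) = callanOK k n r f g ∧ arrangementOK m r w

-- all candidates with r ordinary pairs (the word length is forced to be (r+1)+m+(m+1))
candidates : (m k n r : ℕ) → List (BarredCallan m k n r)
candidates m k n r =
  concatMap (λ f → concatMap (λ g → map (λ w → f , g , w)
      (allWords (allTokens m) (suc r + m + suc m)))
    (allVecs (allFin (suc r)) n))
  (allVecs (allFin (suc r)) k)

-- Number of m-barred Callan sequences of size k × n satisfying an extra property P.
-- r ranges over 0..k: the r ordinary blue blocks are disjoint nonempty
-- subsets of {m+1,…,m+k}, so necessarily r ≤ k.
countBarred : (m k n : ℕ) → ((r : ℕ) → BarredCallan m k n r → Bool) → ℕ
countBarred m k n P =
  sumℕ (map (λ r → countᵇ (λ c → barredOK m k n r c ∧ P r c) (candidates m k n r))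
            (upTo (suc k)))

cardC : (n k m : ℕ) → ℕ
cardC n k m = countBarred m k n (λ r c → true)

-- extra red block R* = {*_r}: no red element is sent to the extra pair
redStarOnly : (n k m r : ℕ) → BarredCallan m k n r → Bool
redStarOnly n k m r (f , g , w) = allᵇ (λ y → not (lookup g y ==F fromℕ r)) (allFin n)

-- the pair with (0-based) index j among the pair tokens of w is immediately
-- preceded by a bar (first argument: whether the previous token was a bar)
pairPrecededByBar : {m : ℕ} → Bool → ℕ → List (Token m) → Bool
pairPrecededByBar p j [] = false
pairPrecededByBar p zero (pair ∷ w) = p
pairPrecededByBar p (suc j) (pair ∷ w) = pairPrecededByBar false j w
pairPrecededByBar p j (bbar _ ∷ w) = pairPrecededByBar true j w
pairPrecededByBar p j (rbar _ ∷ w) = pairPrecededByBar true j w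

-- for k = suc k', the maximal blue element m+k is x = fromℕ k' : Fin (suc k').
-- It forms alone the blue block of an ordinary pair, and that pair is
-- immediately preceded by at least one bar.
maxBlueAlone : (n k' m r : ℕ) → BarredCallan m (suc k') n r → Bool
maxBlueAlone n k' m r (f , g , w) =
  not (lookup f (fromℕ k') ==F fromℕ r)
  ∧ allᵇ (λ x → (x ==F fromℕ k') ∨ not (lookup f x ==F lookup f (fromℕ k'))) (allFin (suc k'))
  ∧ pairPrecededByBar false (toℕ (lookup f (fromℕ k'))) w

-- |C_n^k(m,*,|m+k)|, empty for k = 0 by convention
cardCStarBar : (n k m : ℕ) → ℕ
cardCStarBar n zero m = 0
cardCStarBar n (suc k') m =
  countBarred m (suc k') n
    (λ r c → redStarOnly n (suc k') m r c ∧ maxBlueAlone n k' m r c)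

altSum : (ℕ → ℕ) → ℕ → ℤ
altSum a zero = + a 0
altSum a (suc n) = altSum a n +ℤ ((-1ℤ ^ suc n) *ℤ (+ a (suc n)))

module Submission where

open import Defs
open import Data.Nat using (ℕ; _≥_; _∸_)
open import Relation.Binary.PropositionalEquality using (_≡_)

-- Both sides are sums over the number r of ordinary pairs. A sequence with r ordinary pairs is a
-- blue and a red map onto the pair indices hitting every ordinary pair, counted by
-- surj k (r+1) + surj k r with surj k s the number of surjections, times one of A_r arrangements
-- of the pairs and bars. On the right the red map avoids the extra pair (surj n r ways), and the
-- pair holding m+k alone must follow a bar; deleting a pair that follows a pair or starts the word
-- leaves A_r - A_(r-1) such arrangements, so the right side is
-- Σ_r surj (n-j) r · surj j r · (A_r - A_(r-1)). Writing β_r = Σ_j (-1)^j surj j r · surj (n-j) r,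
-- the recursion surj (j+1) (r+1) = (r+1) (surj j (r+1) + surj j r) makes the left side
-- Σ_r A_r (β_r - β_(r+1)), and summation by parts with β_0 = β_(n+1) = 0 gives the right side.

module Enumeration where

  open import Algebra.Bundles using (CommutativeMonoid)
  open import Data.Nat using (zero; suc; _+_; _*_; _≤_; s≤s; z≤n; _≡ᵇ_)
  open import Data.Nat.Properties
    using (+-identityʳ; +-assoc; +-comm; +-cancelʳ-≡; *-zeroʳ; *-comm; *-assoc; *-distribˡ-+;
           +-commutativeSemigroup)
  open import Data.Bool using (Bool; true; false; _∧_; _∨_; not; if_then_else_)
  open import Data.Bool.Properties
    using (∧-assoc; ∧-comm; ∧-zeroʳ; ∧-identityʳ; ∨-assoc; ∨-zeroʳ; ∨-identityʳ; ∧-commutativeMonoid)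
  open import Data.Fin using (Fin; toℕ; fromℕ; inject₁; punchIn) renaming (zero to fz; suc to fs)
  open import Data.Fin.Properties using (toℕ-inject₁; toℕ≤n; _≟_)
  open import Data.Vec using (Vec; lookup; []; _∷_; _∷ʳ_) renaming (map to vmap)
  open import Data.List using (List; []; _∷_; map; concatMap; allFin; upTo; tabulate; _++_)
  open import Data.Product using (_,_; proj₁; proj₂)
  open import Relation.Binary.PropositionalEquality
  open import Relation.Nullary using (_because_)
  open import Function using (_∘_; id)
  open import Algebra.Properties.CommutativeSemigroup +-commutativeSemigroup
    using (interchange)
  open import Algebra.Properties.CommutativeSemigroup
    (CommutativeMonoid.commutativeSemigroup ∧-commutativeMonoid)
    using () renaming (interchange to ∧-interchange)
  open import Data.Nat.Tactic.RingSolver using (solve-∀)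
  open ≡-Reasoning

  ⌜_⌝ : Bool → ℕ
  ⌜ true ⌝ = 1
  ⌜ false ⌝ = 0

  ⌜∧⌝ : (a b : Bool) → ⌜ a ∧ b ⌝ ≡ ⌜ a ⌝ * ⌜ b ⌝
  ⌜∧⌝ true b = sym (+-identityʳ ⌜ b ⌝)
  ⌜∧⌝ false b = refl

  ⌜⌝-split : (a b : Bool) → ⌜ a ⌝ ≡ ⌜ a ∧ b ⌝ + ⌜ a ∧ not b ⌝
  ⌜⌝-split true true = refl
  ⌜⌝-split true false = refl
  ⌜⌝-split false b = refl

  ⌜∧not⌝ : (a c : Bool) → ⌜ a ∧ not c ⌝ ≡ (if c then 0 else ⌜ a ⌝)
  ⌜∧not⌝ a true = cong ⌜_⌝ (∧-zeroʳ a)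
  ⌜∧not⌝ a false = cong ⌜_⌝ (∧-identityʳ a)

  ⌜∧∧⌝ : (a c h : Bool) → ⌜ a ∧ (c ∧ h) ⌝ ≡ ⌜ h ⌝ * ⌜ a ∧ c ⌝
  ⌜∧∧⌝ a c true = trans (cong (λ z → ⌜ a ∧ z ⌝) (∧-identityʳ c)) (sym (+-identityʳ _))
  ⌜∧∧⌝ a c false = trans (cong (λ z → ⌜ a ∧ z ⌝) (∧-zeroʳ c)) (cong ⌜_⌝ (∧-zeroʳ a))

  ∧-pull : (a b x d : Bool) → (a ∧ b ∧ (x ∧ d)) ≡ (x ∧ (a ∧ b ∧ d))
  ∧-pull a b true d = refl
  ∧-pull a b false d = trans (cong (λ z → a ∧ z) (∧-zeroʳ b)) (∧-zeroʳ a)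

  ⌜∧⌝-absurd : (a r q : Bool) → (a ∧ q) ≡ false → ⌜ (a ∧ r) ∧ q ⌝ ≡ 0
  ⌜∧⌝-absurd false r q e = refl
  ⌜∧⌝-absurd true r q e = trans (cong (λ z → ⌜ r ∧ z ⌝) e) (cong ⌜_⌝ (∧-zeroʳ r))

  ⌜∧⌝-rearrange : (a b c d e : Bool) → ⌜ ((a ∧ b) ∧ c) ∧ (d ∧ e) ⌝ ≡ ⌜ b ∧ d ⌝ * ⌜ c ∧ (a ∧ e) ⌝
  ⌜∧⌝-rearrange a b c d e = begin
    ⌜ ((a ∧ b) ∧ c) ∧ (d ∧ e) ⌝
      ≡⟨ ⌜∧⌝ ((a ∧ b) ∧ c) (d ∧ e) ⟩
    ⌜ (a ∧ b) ∧ c ⌝ * ⌜ d ∧ e ⌝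
      ≡⟨ cong₂ _*_ (trans (⌜∧⌝ (a ∧ b) c) (cong (_* ⌜ c ⌝) (⌜∧⌝ a b))) (⌜∧⌝ d e) ⟩
    ⌜ a ⌝ * ⌜ b ⌝ * ⌜ c ⌝ * (⌜ d ⌝ * ⌜ e ⌝)
      ≡⟨ reorder ⌜ a ⌝ ⌜ b ⌝ ⌜ c ⌝ ⌜ d ⌝ ⌜ e ⌝ ⟩
    ⌜ b ⌝ * ⌜ d ⌝ * (⌜ c ⌝ * (⌜ a ⌝ * ⌜ e ⌝))
      ≡⟨ sym (cong₂ _*_ (⌜∧⌝ b d) (trans (⌜∧⌝ c (a ∧ e)) (cong (⌜ c ⌝ *_) (⌜∧⌝ a e)))) ⟩
    ⌜ b ∧ d ⌝ * ⌜ c ∧ (a ∧ e) ⌝ ∎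
    where
    reorder : ∀ a b c d e → a * b * c * (d * e) ≡ b * d * (c * (a * e))
    reorder = solve-∀

  -- Finite sums

  ΣL : {A : Set} → List A → (A → ℕ) → ℕ
  ΣL [] f = 0
  ΣL (x ∷ xs) f = f x + ΣL xs f

  countᵇ≡ΣL : {A : Set} (p : A → Bool) (xs : List A) → countᵇ p xs ≡ ΣL xs (λ x → ⌜ p x ⌝)
  countᵇ≡ΣL p [] = refl
  countᵇ≡ΣL p (x ∷ xs) with p x
  ... | true = cong suc (countᵇ≡ΣL p xs)
  ... | false = countᵇ≡ΣL p xs

  ΣL-cong : {A : Set} (xs : List A) {f g : A → ℕ} → (∀ x → f x ≡ g x) → ΣL xs f ≡ ΣL xs g
  ΣL-cong [] e = refl
  ΣL-cong (x ∷ xs) e = cong₂ _+_ (e x) (ΣL-cong xs e)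

  ΣL-++ : {A : Set} (xs ys : List A) (f : A → ℕ) → ΣL (xs ++ ys) f ≡ ΣL xs f + ΣL ys f
  ΣL-++ [] ys f = refl
  ΣL-++ (x ∷ xs) ys f = trans (cong (f x +_) (ΣL-++ xs ys f)) (sym (+-assoc (f x) _ _))

  ΣL-map : {A B : Set} (g : A → B) (xs : List A) (f : B → ℕ) → ΣL (map g xs) f ≡ ΣL xs (f ∘ g)
  ΣL-map g [] f = refl
  ΣL-map g (x ∷ xs) f = cong (f (g x) +_) (ΣL-map g xs f)

  ΣL-concatMap : {A B : Set} (g : A → List B) (xs : List A) (f : B → ℕ) →
    ΣL (concatMap g xs) f ≡ ΣL xs (λ x → ΣL (g x) f)
  ΣL-concatMap g [] f = refl
  ΣL-concatMap g (x ∷ xs) f =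
    trans (ΣL-++ (g x) (concatMap g xs) f) (cong (ΣL (g x) f +_) (ΣL-concatMap g xs f))

  ΣL-+ : {A : Set} (xs : List A) (f g : A → ℕ) → ΣL xs (λ x → f x + g x) ≡ ΣL xs f + ΣL xs g
  ΣL-+ [] f g = refl
  ΣL-+ (x ∷ xs) f g =
    trans (cong (f x + g x +_) (ΣL-+ xs f g)) (interchange (f x) (g x) (ΣL xs f) (ΣL xs g))

  ΣL-* : {A : Set} (xs : List A) (c : ℕ) (f : A → ℕ) → ΣL xs (λ x → c * f x) ≡ c * ΣL xs f
  ΣL-* [] c f = sym (*-zeroʳ c)
  ΣL-* (x ∷ xs) c f =
    trans (cong (c * f x +_) (ΣL-* xs c f)) (sym (*-distribˡ-+ c (f x) (ΣL xs f)))

  ΣL-⌜∧⌝ : {A : Set} (xs : List A) (a : Bool) (P : A → Bool) →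
    ΣL xs (λ x → ⌜ a ∧ P x ⌝) ≡ ⌜ a ⌝ * ΣL xs (λ x → ⌜ P x ⌝)
  ΣL-⌜∧⌝ xs a P = trans (ΣL-cong xs (λ x → ⌜∧⌝ a (P x))) (ΣL-* xs ⌜ a ⌝ _)

  ΣL-zero : {A : Set} (xs : List A) → ΣL xs (λ _ → 0) ≡ 0
  ΣL-zero [] = refl
  ΣL-zero (x ∷ xs) = ΣL-zero xs

  ΣF : (n : ℕ) → (Fin n → ℕ) → ℕ
  ΣF zero f = 0
  ΣF (suc n) f = f fz + ΣF n (f ∘ fs)

  ΣF-cong : (n : ℕ) {f g : Fin n → ℕ} → (∀ x → f x ≡ g x) → ΣF n f ≡ ΣF n g
  ΣF-cong zero e = refl
  ΣF-cong (suc n) e = cong₂ _+_ (e fz) (ΣF-cong n (e ∘ fs))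

  ΣL-tabulate : {A : Set} (n : ℕ) (h : Fin n → A) (f : A → ℕ) → ΣL (tabulate h) f ≡ ΣF n (f ∘ h)
  ΣL-tabulate zero h f = refl
  ΣL-tabulate (suc n) h f = cong (f (h fz) +_) (ΣL-tabulate n (h ∘ fs) f)

  ΣF-const : (n c : ℕ) → ΣF n (λ _ → c) ≡ n * c
  ΣF-const zero c = refl
  ΣF-const (suc n) c = cong (c +_) (ΣF-const n c)

  ΣF-zero : (n : ℕ) → ΣF n (λ _ → 0) ≡ 0
  ΣF-zero n = trans (ΣF-const n 0) (*-zeroʳ n)

  ΣF-+ : (n : ℕ) (f g : Fin n → ℕ) → ΣF n (λ x → f x + g x) ≡ ΣF n f + ΣF n g
  ΣF-+ zero f g = refl
  ΣF-+ (suc n) f g =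
    trans (cong (f fz + g fz +_) (ΣF-+ n (f ∘ fs) (g ∘ fs)))
          (interchange (f fz) (g fz) (ΣF n (f ∘ fs)) (ΣF n (g ∘ fs)))

  ΣF-* : (n c : ℕ) (f : Fin n → ℕ) → ΣF n (λ x → c * f x) ≡ c * ΣF n f
  ΣF-* zero c f = sym (*-zeroʳ c)
  ΣF-* (suc n) c f =
    trans (cong (c * f fz +_) (ΣF-* n c (f ∘ fs))) (sym (*-distribˡ-+ c (f fz) (ΣF n (f ∘ fs))))

  ΣF-swap : (n m : ℕ) (G : Fin n → Fin m → ℕ) →
    ΣF n (λ x → ΣF m (G x)) ≡ ΣF m (λ y → ΣF n (λ x → G x y))
  ΣF-swap zero m G = sym (ΣF-zero m)
  ΣF-swap (suc n) m G =
    trans (cong (ΣF m (G fz) +_) (ΣF-swap n m (G ∘ fs)))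
          (sym (ΣF-+ m (G fz) (λ y → ΣF n (λ x → G (fs x) y))))

  ΣF-ΣL : {A : Set} (n : ℕ) (xs : List A) (F : Fin n → A → ℕ) →
    ΣF n (λ i → ΣL xs (F i)) ≡ ΣL xs (λ x → ΣF n (λ i → F i x))
  ΣF-ΣL zero xs F = sym (ΣL-zero xs)
  ΣF-ΣL (suc n) xs F =
    trans (cong (ΣL xs (F fz) +_) (ΣF-ΣL n xs (F ∘ fs))) (sym (ΣL-+ xs (F fz) _))

  ΣV : (s k : ℕ) → (Vec (Fin s) k → ℕ) → ℕ
  ΣV s zero F = F []
  ΣV s (suc k) F = ΣF s (λ x → ΣV s k (λ v → F (x ∷ v)))

  ΣV-cong : (s k : ℕ) {F G : Vec (Fin s) k → ℕ} → (∀ v → F v ≡ G v) → ΣV s k F ≡ ΣV s k G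
  ΣV-cong s zero e = e []
  ΣV-cong s (suc k) e = ΣF-cong s (λ x → ΣV-cong s k (λ v → e (x ∷ v)))

  ΣV-zero : (s k : ℕ) → ΣV s k (λ _ → 0) ≡ 0
  ΣV-zero s zero = refl
  ΣV-zero s (suc k) = trans (ΣF-cong s (λ x → ΣV-zero s k)) (ΣF-zero s)

  ΣV-+ : (s k : ℕ) (F G : Vec (Fin s) k → ℕ) → ΣV s k (λ v → F v + G v) ≡ ΣV s k F + ΣV s k G
  ΣV-+ s zero F G = refl
  ΣV-+ s (suc k) F G = trans (ΣF-cong s (λ x → ΣV-+ s k _ _)) (ΣF-+ s _ _)

  ΣV-* : (s k c : ℕ) (F : Vec (Fin s) k → ℕ) → ΣV s k (λ v → c * F v) ≡ c * ΣV s k F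
  ΣV-* s zero c F = refl
  ΣV-* s (suc k) c F = trans (ΣF-cong s (λ x → ΣV-* s k c _)) (ΣF-* s c _)

  ΣV-*ʳ : (s k c : ℕ) (F : Vec (Fin s) k → ℕ) → ΣV s k (λ v → F v * c) ≡ ΣV s k F * c
  ΣV-*ʳ s k c F = trans (ΣV-cong s k (λ v → *-comm (F v) c)) (trans (ΣV-* s k c F) (*-comm c _))

  ΣV-ΣL : {A : Set} (s k : ℕ) (xs : List A) (F : Vec (Fin s) k → A → ℕ) →
    ΣV s k (λ v → ΣL xs (F v)) ≡ ΣL xs (λ x → ΣV s k (λ v → F v x))
  ΣV-ΣL s zero xs F = refl
  ΣV-ΣL s (suc k) xs F = trans (ΣF-cong s (λ i → ΣV-ΣL s k xs (λ v → F (i ∷ v)))) (ΣF-ΣL s xs _)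

  ΣV-∷ʳ : (s k : ℕ) (F : Vec (Fin s) (suc k) → ℕ) →
    ΣV s (suc k) F ≡ ΣF s (λ y → ΣV s k (λ v → F (v ∷ʳ y)))
  ΣV-∷ʳ s zero F = refl
  ΣV-∷ʳ s (suc k) F =
    trans (ΣF-cong s (λ x → ΣV-∷ʳ s k (λ v → F (x ∷ v))))
          (ΣF-swap s s (λ x y → ΣV s k (λ v → F (x ∷ (v ∷ʳ y)))))

  ΣL-allVecs : (s k : ℕ) (F : Vec (Fin s) k → ℕ) → ΣL (allVecs (allFin s) k) F ≡ ΣV s k F
  ΣL-allVecs s zero F = +-identityʳ (F [])
  ΣL-allVecs s (suc k) F = begin
    ΣL (concatMap (λ x → map (x ∷_) (allVecs (allFin s) k)) (allFin s)) F
      ≡⟨ ΣL-concatMap _ (allFin s) F ⟩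
    ΣL (allFin s) (λ x → ΣL (map (x ∷_) (allVecs (allFin s) k)) F)
      ≡⟨ ΣL-tabulate s id _ ⟩
    ΣF s (λ x → ΣL (map (x ∷_) (allVecs (allFin s) k)) F)
      ≡⟨ ΣF-cong s (λ x → trans (ΣL-map (x ∷_) (allVecs (allFin s) k) F) (ΣL-allVecs s k (λ v → F (x ∷ v)))) ⟩
    ΣV s (suc k) F ∎

  ==F-suc : {n : ℕ} (i j : Fin n) → (fs i ==F fs j) ≡ (i ==F j)
  ==F-suc i j with i ≟ j
  ... | true because _ = refl
  ... | false because _ = refl

  ==F-refl : {n : ℕ} (i : Fin n) → (i ==F i) ≡ true
  ==F-refl fz = refl
  ==F-refl (fs i) = trans (==F-suc i i) (==F-refl i)

  ==F-sym : {n : ℕ} (i j : Fin n) → (i ==F j) ≡ (j ==F i)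
  ==F-sym fz fz = refl
  ==F-sym fz (fs j) = refl
  ==F-sym (fs i) fz = refl
  ==F-sym (fs i) (fs j) = trans (==F-suc i j) (trans (==F-sym i j) (sym (==F-suc j i)))

  punchIn-==F : {n : ℕ} (y : Fin (suc n)) (a c : Fin n) → (punchIn y a ==F punchIn y c) ≡ (a ==F c)
  punchIn-==F fz a c = ==F-suc a c
  punchIn-==F (fs y) fz fz = refl
  punchIn-==F (fs y) fz (fs c) = refl
  punchIn-==F (fs y) (fs a) fz = refl
  punchIn-==F (fs y) (fs a) (fs c) =
    trans (==F-suc _ _) (trans (punchIn-==F y a c) (sym (==F-suc a c)))

  ==F-punchInᵢ : {n : ℕ} (y : Fin (suc n)) (c : Fin n) → (y ==F punchIn y c) ≡ false
  ==F-punchInᵢ fz c = refl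
  ==F-punchInᵢ (fs y) fz = refl
  ==F-punchInᵢ (fs y) (fs c) = trans (==F-suc y (punchIn y c)) (==F-punchInᵢ y c)

  punchInᵢ-==F : {n : ℕ} (y : Fin (suc n)) (c : Fin n) → (punchIn y c ==F y) ≡ false
  punchInᵢ-==F y c = trans (==F-sym (punchIn y c) y) (==F-punchInᵢ y c)

  punchIn-fromℕ : {n : ℕ} (i : Fin n) → punchIn (fromℕ n) i ≡ inject₁ i
  punchIn-fromℕ fz = refl
  punchIn-fromℕ (fs i) = cong fs (punchIn-fromℕ i)

  inject₁-==F-fromℕ : {n : ℕ} (b : Fin n) → (inject₁ b ==F fromℕ n) ≡ false
  inject₁-==F-fromℕ {n} b =
    trans (cong (_==F fromℕ n) (sym (punchIn-fromℕ b))) (punchInᵢ-==F (fromℕ n) b)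

  inject₁-punchIn : {n : ℕ} (y : Fin (suc n)) (b : Fin n) →
    inject₁ (punchIn y b) ≡ punchIn (inject₁ y) (inject₁ b)
  inject₁-punchIn fz b = refl
  inject₁-punchIn (fs y) fz = refl
  inject₁-punchIn (fs y) (fs b) = cong fs (inject₁-punchIn y b)

  ΣF-punchIn : (s : ℕ) (b : Fin (suc s)) (h : Fin (suc s) → ℕ) →
    ΣF (suc s) h ≡ h b + ΣF s (h ∘ punchIn b)
  ΣF-punchIn s fz h = refl
  ΣF-punchIn (suc s) (fs b) h = begin
    h fz + ΣF (suc s) (h ∘ fs)                   ≡⟨ cong (h fz +_) (ΣF-punchIn s b (h ∘ fs)) ⟩
    h fz + (h (fs b) + ΣF s (h ∘ fs ∘ punchIn b)) ≡⟨ sym (+-assoc (h fz) _ _) ⟩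
    h fz + h (fs b) + ΣF s (h ∘ fs ∘ punchIn b)   ≡⟨ cong (_+ ΣF s (h ∘ fs ∘ punchIn b)) (+-comm (h fz) _) ⟩
    h (fs b) + h fz + ΣF s (h ∘ fs ∘ punchIn b)   ≡⟨ +-assoc (h (fs b)) (h fz) _ ⟩
    h (fs b) + ΣF (suc s) (h ∘ punchIn (fs b))    ∎

  ΣF-skip : (s : ℕ) (b : Fin (suc s)) (h : Fin (suc s) → ℕ) →
    ΣF (suc s) (λ x → if x ==F b then 0 else h x) ≡ ΣF s (h ∘ punchIn b)
  ΣF-skip s fz h = refl
  ΣF-skip (suc s) (fs b) h =
    cong (h fz +_) (trans (ΣF-cong (suc s) (λ x → cong (λ c → if c then 0 else h (fs x)) (==F-suc x b)))
                          (ΣF-skip s b (h ∘ fs)))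

  allF : (n : ℕ) → (Fin n → Bool) → Bool
  allF zero g = true
  allF (suc n) g = g fz ∧ allF n (g ∘ fs)

  anyF : (n : ℕ) → (Fin n → Bool) → Bool
  anyF zero g = false
  anyF (suc n) g = g fz ∨ anyF n (g ∘ fs)

  allF-cong : (n : ℕ) {f g : Fin n → Bool} → (∀ x → f x ≡ g x) → allF n f ≡ allF n g
  allF-cong zero e = refl
  allF-cong (suc n) e = cong₂ _∧_ (e fz) (allF-cong n (e ∘ fs))

  allᵇ-cong : {A : Set} (xs : List A) {f g : A → Bool} → (∀ x → f x ≡ g x) → allᵇ f xs ≡ allᵇ g xs
  allᵇ-cong [] e = refl
  allᵇ-cong (x ∷ xs) e = cong₂ _∧_ (e x) (allᵇ-cong xs e)

  allᵇ-tabulate : {A : Set} (n : ℕ) (h : Fin n → A) (p : A → Bool) →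
    allᵇ p (tabulate h) ≡ allF n (p ∘ h)
  allᵇ-tabulate zero h p = refl
  allᵇ-tabulate (suc n) h p = cong (p (h fz) ∧_) (allᵇ-tabulate n (h ∘ fs) p)

  anyᵇ-tabulate : {A : Set} (n : ℕ) (h : Fin n → A) (p : A → Bool) →
    anyᵇ p (tabulate h) ≡ anyF n (p ∘ h)
  anyᵇ-tabulate zero h p = refl
  anyᵇ-tabulate (suc n) h p = cong (p (h fz) ∨_) (anyᵇ-tabulate n (h ∘ fs) p)

  allF-∧ : (n : ℕ) (f g : Fin n → Bool) → allF n (λ x → f x ∧ g x) ≡ allF n f ∧ allF n g
  allF-∧ zero f g = refl
  allF-∧ (suc n) f g =
    trans (cong ((f fz ∧ g fz) ∧_) (allF-∧ n (f ∘ fs) (g ∘ fs)))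
          (∧-interchange (f fz) (g fz) (allF n (f ∘ fs)) (allF n (g ∘ fs)))

  allF-punchIn : (s : ℕ) (b : Fin (suc s)) (g : Fin (suc s) → Bool) →
    allF (suc s) g ≡ g b ∧ allF s (g ∘ punchIn b)
  allF-punchIn s fz g = refl
  allF-punchIn (suc s) (fs b) g =
    trans (cong (g fz ∧_) (allF-punchIn s b (g ∘ fs))) (swap (g fz) (g (fs b)) _)
    where
    swap : ∀ a b c → a ∧ (b ∧ c) ≡ b ∧ (a ∧ c)
    swap true b c = refl
    swap false true c = refl
    swap false false c = refl

  occurs : {s k : ℕ} → Fin s → Vec (Fin s) k → Bool
  occurs c [] = false
  occurs c (y ∷ v) = (y ==F c) ∨ occurs c v

  anyF-lookup : {s k : ℕ} (c : Fin s) (v : Vec (Fin s) k) → anyF k (λ x → lookup v x ==F c) ≡ occurs c v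
  anyF-lookup c [] = refl
  anyF-lookup c (y ∷ v) = cong ((y ==F c) ∨_) (anyF-lookup c v)

  allV : {A : Set} {k : ℕ} → (A → Bool) → Vec A k → Bool
  allV p [] = true
  allV p (y ∷ v) = p y ∧ allV p v

  allF-lookup : {A : Set} {k : ℕ} (p : A → Bool) (v : Vec A k) → allF k (λ x → p (lookup v x)) ≡ allV p v
  allF-lookup p [] = refl
  allF-lookup p (y ∷ v) = cong (p y ∧_) (allF-lookup p v)

  allV-≠ : {s k : ℕ} (y : Fin s) (v : Vec (Fin s) k) → allV (λ a → not (a ==F y)) v ≡ not (occurs y v)
  allV-≠ y [] = refl
  allV-≠ y (a ∷ v) with a ==F y
  ... | true = refl
  ... | false = allV-≠ y v

  occurs-∷ʳ : {s k : ℕ} (c : Fin s) (v : Vec (Fin s) k) (y : Fin s) →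
    occurs c (v ∷ʳ y) ≡ occurs c v ∨ (y ==F c)
  occurs-∷ʳ c [] y = ∨-identityʳ (y ==F c)
  occurs-∷ʳ c (a ∷ v) y =
    trans (cong ((a ==F c) ∨_) (occurs-∷ʳ c v y)) (sym (∨-assoc (a ==F c) (occurs c v) (y ==F c)))

  occurs-punchIn : {n k : ℕ} (y : Fin (suc n)) (c : Fin n) (u : Vec (Fin n) k) →
    occurs (punchIn y c) (vmap (punchIn y) u) ≡ occurs c u
  occurs-punchIn y c [] = refl
  occurs-punchIn y c (a ∷ u) = cong₂ _∨_ (punchIn-==F y a c) (occurs-punchIn y c u)

  ΣV-avoiding : (s k : ℕ) (b : Fin (suc s)) (F : Vec (Fin (suc s)) k → ℕ) →
    ΣV (suc s) k (λ v → if occurs b v then 0 else F v) ≡ ΣV s k (λ u → F (vmap (punchIn b) u))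
  ΣV-avoiding s zero b F = refl
  ΣV-avoiding s (suc k) b F = begin
    ΣF (suc s) (λ x → ΣV (suc s) k (λ v → if (x ==F b) ∨ occurs b v then 0 else F (x ∷ v)))
      ≡⟨ ΣF-cong (suc s) head-avoids ⟩
    ΣF (suc s) (λ x → if x ==F b then 0 else ΣV (suc s) k (λ v → if occurs b v then 0 else F (x ∷ v)))
      ≡⟨ ΣF-skip s b (λ x → ΣV (suc s) k (λ v → if occurs b v then 0 else F (x ∷ v))) ⟩
    ΣF s (λ i → ΣV (suc s) k (λ v → if occurs b v then 0 else F (punchIn b i ∷ v)))
      ≡⟨ ΣF-cong s (λ i → ΣV-avoiding s k b (λ v → F (punchIn b i ∷ v))) ⟩
    ΣV s (suc k) (λ u → F (vmap (punchIn b) u)) ∎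
    where
    head-avoids : ∀ x → ΣV (suc s) k (λ v → if (x ==F b) ∨ occurs b v then 0 else F (x ∷ v))
                      ≡ (if x ==F b then 0 else ΣV (suc s) k (λ v → if occurs b v then 0 else F (x ∷ v)))
    head-avoids x with x ==F b
    ... | true = ΣV-zero (suc s) k
    ... | false = refl

  -- Surjections and Callan colourings

  surj : ℕ → ℕ → ℕ
  surj zero zero = 1
  surj zero (suc s) = 0
  surj (suc k) zero = 0
  surj (suc k) (suc s) = suc s * (surj k (suc s) + surj k s)

  onto : {s k : ℕ} → Vec (Fin s) k → Bool
  onto {s} v = allF s (λ c → occurs c v)

  ΣV-∧-not-occurs : (s k : ℕ) (y : Fin (suc s)) (P : Vec (Fin (suc s)) k → Bool) →
    ΣV (suc s) k (λ v → ⌜ P v ∧ not (occurs y v) ⌝) ≡ ΣV s k (λ u → ⌜ P (vmap (punchIn y) u) ⌝)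
  ΣV-∧-not-occurs s k y P =
    trans (ΣV-cong (suc s) k (λ v → ⌜∧not⌝ (P v) (occurs y v))) (ΣV-avoiding s k y (λ v → ⌜ P v ⌝))

  ΣV-split-occurs : (s k : ℕ) (y : Fin (suc s)) (P : Vec (Fin (suc s)) k → Bool) →
    ΣV (suc s) k (λ v → ⌜ P v ⌝)
      ≡ ΣV (suc s) k (λ v → ⌜ P v ∧ occurs y v ⌝) + ΣV s k (λ u → ⌜ P (vmap (punchIn y) u) ⌝)
  ΣV-split-occurs s k y P =
    trans (ΣV-cong (suc s) k (λ v → ⌜⌝-split (P v) (occurs y v)))
          (trans (ΣV-+ (suc s) k _ _) (cong (ΣV (suc s) k (λ v → ⌜ P v ∧ occurs y v ⌝) +_)
                                             (ΣV-∧-not-occurs s k y P)))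

  ΣV-onto : (k s : ℕ) → ΣV s k (λ v → ⌜ onto v ⌝) ≡ surj k s
  ΣV-onto zero zero = refl
  ΣV-onto zero (suc s) = refl
  ΣV-onto (suc k) zero = refl
  ΣV-onto (suc k) (suc s) =
    trans (ΣF-cong (suc s) first) (ΣF-const (suc s) _)
    where
    ontoBut : Fin (suc s) → Vec (Fin (suc s)) k → Bool
    ontoBut y v = allF s (λ c → occurs (punchIn y c) v)
    onto-∷ : ∀ y v → onto (y ∷ v) ≡ ontoBut y v
    onto-∷ y v = begin
      onto (y ∷ v)
        ≡⟨ allF-punchIn s y (λ c → (y ==F c) ∨ occurs c v) ⟩
      ((y ==F y) ∨ occurs y v) ∧ allF s (λ c → (y ==F punchIn y c) ∨ occurs (punchIn y c) v)
        ≡⟨ cong₂ (λ a b → (a ∨ occurs y v) ∧ b) (==F-refl y)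
                 (allF-cong s (λ c → cong (_∨ occurs (punchIn y c) v) (==F-punchInᵢ y c))) ⟩
      ontoBut y v ∎
    ontoBut-∧-occurs : ∀ y v → (ontoBut y v ∧ occurs y v) ≡ onto v
    ontoBut-∧-occurs y v =
      trans (∧-comm (ontoBut y v) (occurs y v)) (sym (allF-punchIn s y (λ c → occurs c v)))
    first : ∀ y → ΣV (suc s) k (λ v → ⌜ onto (y ∷ v) ⌝) ≡ surj k (suc s) + surj k s
    first y = begin
      ΣV (suc s) k (λ v → ⌜ onto (y ∷ v) ⌝)
        ≡⟨ ΣV-cong (suc s) k (λ v → cong ⌜_⌝ (onto-∷ y v)) ⟩
      ΣV (suc s) k (λ v → ⌜ ontoBut y v ⌝)
        ≡⟨ ΣV-split-occurs s k y (ontoBut y) ⟩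
      ΣV (suc s) k (λ v → ⌜ ontoBut y v ∧ occurs y v ⌝) + ΣV s k (λ u → ⌜ ontoBut y (vmap (punchIn y) u) ⌝)
        ≡⟨ cong₂ _+_ (ΣV-cong (suc s) k (λ v → cong ⌜_⌝ (ontoBut-∧-occurs y v)))
                     (ΣV-cong s k (λ u → cong ⌜_⌝ (allF-cong s (λ c → occurs-punchIn y c u)))) ⟩
      ΣV (suc s) k (λ v → ⌜ onto v ⌝) + ΣV s k (λ u → ⌜ onto u ⌝)
        ≡⟨ cong₂ _+_ (ΣV-onto k (suc s)) (ΣV-onto k s) ⟩
      surj k (suc s) + surj k s ∎

  coversOrdinary : {r k : ℕ} → Vec (Fin (suc r)) k → Bool
  coversOrdinary {r} v = allF r (λ b → occurs (inject₁ b) v)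

  covers : ℕ → ℕ → ℕ
  covers k r = surj k (suc r) + surj k r

  coversOrdinary-∧-occurs-extra : {r k : ℕ} (v : Vec (Fin (suc r)) k) →
    (coversOrdinary v ∧ occurs (fromℕ r) v) ≡ onto v
  coversOrdinary-∧-occurs-extra {r} v = begin
    coversOrdinary v ∧ occurs (fromℕ r) v
      ≡⟨ ∧-comm (coversOrdinary v) _ ⟩
    occurs (fromℕ r) v ∧ coversOrdinary v
      ≡⟨ cong (occurs (fromℕ r) v ∧_) (allF-cong r (λ b → cong (λ c → occurs c v) (sym (punchIn-fromℕ b)))) ⟩
    occurs (fromℕ r) v ∧ allF r (λ b → occurs (punchIn (fromℕ r) b) v)
      ≡⟨ sym (allF-punchIn r (fromℕ r) (λ c → occurs c v)) ⟩
    onto v ∎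

  coversOrdinary-punchIn-extra : {r k : ℕ} (u : Vec (Fin r) k) →
    coversOrdinary (vmap (punchIn (fromℕ r)) u) ≡ onto u
  coversOrdinary-punchIn-extra {r} u = allF-cong r (λ b →
    trans (cong (λ c → occurs c (vmap (punchIn (fromℕ r)) u)) (sym (punchIn-fromℕ b)))
          (occurs-punchIn (fromℕ r) b u))

  ΣV-coversOrdinary-avoiding-extra : (k r : ℕ) →
    ΣV (suc r) k (λ v → ⌜ coversOrdinary v ∧ not (occurs (fromℕ r) v) ⌝) ≡ surj k r
  ΣV-coversOrdinary-avoiding-extra k r =
    trans (ΣV-∧-not-occurs r k (fromℕ r) coversOrdinary)
          (trans (ΣV-cong r k (λ u → cong ⌜_⌝ (coversOrdinary-punchIn-extra u))) (ΣV-onto k r))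

  ΣV-coversOrdinary : (k r : ℕ) → ΣV (suc r) k (λ v → ⌜ coversOrdinary v ⌝) ≡ covers k r
  ΣV-coversOrdinary k r = begin
    ΣV (suc r) k (λ v → ⌜ coversOrdinary v ⌝)
      ≡⟨ ΣV-split-occurs r k (fromℕ r) coversOrdinary ⟩
    ΣV (suc r) k (λ v → ⌜ coversOrdinary v ∧ occurs (fromℕ r) v ⌝)
      + ΣV r k (λ u → ⌜ coversOrdinary (vmap (punchIn (fromℕ r)) u) ⌝)
      ≡⟨ cong₂ _+_ (ΣV-cong (suc r) k (λ v → cong ⌜_⌝ (coversOrdinary-∧-occurs-extra v)))
                   (ΣV-cong r k (λ u → cong ⌜_⌝ (coversOrdinary-punchIn-extra u))) ⟩
    ΣV (suc r) k (λ v → ⌜ onto v ⌝) + ΣV r k (λ u → ⌜ onto u ⌝)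
      ≡⟨ cong₂ _+_ (ΣV-onto k (suc r)) (ΣV-onto k r) ⟩
    covers k r ∎

  -- The maximal blue element alone in an ordinary pair

  lookup-∷ʳ-last : {A : Set} {k : ℕ} (v : Vec A k) (y : A) → lookup (v ∷ʳ y) (fromℕ k) ≡ y
  lookup-∷ʳ-last [] y = refl
  lookup-∷ʳ-last (a ∷ v) y = lookup-∷ʳ-last v y

  lookup-∷ʳ-inject₁ : {A : Set} {k : ℕ} (v : Vec A k) (y : A) (i : Fin k) →
    lookup (v ∷ʳ y) (inject₁ i) ≡ lookup v i
  lookup-∷ʳ-inject₁ (a ∷ v) y fz = refl
  lookup-∷ʳ-inject₁ (a ∷ v) y (fs i) = lookup-∷ʳ-inject₁ v y i

  -- maxBlueAlone with the condition on the arrangement abstracted to a predicate h on the pair index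
  maxAloneAt : (r k : ℕ) → (ℕ → Bool) → Vec (Fin (suc r)) (suc k) → Bool
  maxAloneAt r k h f =
    not (lookup f (fromℕ k) ==F fromℕ r)
    ∧ allᵇ (λ x → (x ==F fromℕ k) ∨ not (lookup f x ==F lookup f (fromℕ k))) (allFin (suc k))
    ∧ h (toℕ (lookup f (fromℕ k)))

  alone-∷ʳ : {r k : ℕ} (v : Vec (Fin (suc r)) k) (y : Fin (suc r)) →
    allᵇ (λ x → (x ==F fromℕ k) ∨ not (lookup (v ∷ʳ y) x ==F lookup (v ∷ʳ y) (fromℕ k))) (allFin (suc k))
      ≡ not (occurs y v)
  alone-∷ʳ {r} {k} v y = begin
    allᵇ alone (allFin (suc k))
      ≡⟨ allᵇ-tabulate (suc k) id alone ⟩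
    allF (suc k) alone
      ≡⟨ allF-punchIn k (fromℕ k) alone ⟩
    ((fromℕ k ==F fromℕ k) ∨ differs (fromℕ k)) ∧ allF k (alone ∘ punchIn (fromℕ k))
      ≡⟨ cong (λ z → (z ∨ differs (fromℕ k)) ∧ allF k (alone ∘ punchIn (fromℕ k))) (==F-refl (fromℕ k)) ⟩
    allF k (alone ∘ punchIn (fromℕ k))
      ≡⟨ allF-cong k (λ i → cong₂ _∨_ (punchInᵢ-==F (fromℕ k) i) (cong differs (punchIn-fromℕ i))) ⟩
    allF k (λ i → differs (inject₁ i))
      ≡⟨ allF-cong k (λ i → cong₂ (λ a b → not (a ==F b)) (lookup-∷ʳ-inject₁ v y i) (lookup-∷ʳ-last v y)) ⟩
    allF k (λ i → not (lookup v i ==F y))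
      ≡⟨ allF-lookup (λ a → not (a ==F y)) v ⟩
    allV (λ a → not (a ==F y)) v
      ≡⟨ allV-≠ y v ⟩
    not (occurs y v) ∎
    where
    differs : Fin (suc k) → Bool
    differs x = not (lookup (v ∷ʳ y) x ==F lookup (v ∷ʳ y) (fromℕ k))
    alone : Fin (suc k) → Bool
    alone x = (x ==F fromℕ k) ∨ differs x

  maxAloneAt-∷ʳ : (r k : ℕ) (h : ℕ → Bool) (v : Vec (Fin (suc r)) k) (y : Fin (suc r)) →
    maxAloneAt r k h (v ∷ʳ y) ≡ not (y ==F fromℕ r) ∧ (not (occurs y v) ∧ h (toℕ y))
  maxAloneAt-∷ʳ r k h v y =
    cong₂ (λ a b → not (a ==F fromℕ r) ∧ b) (lookup-∷ʳ-last v y)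
          (cong₂ _∧_ (alone-∷ʳ v y) (cong (h ∘ toℕ) (lookup-∷ʳ-last v y)))

  coversOrdinary-∷ʳ : {r k : ℕ} (b : Fin (suc r)) (u : Vec (Fin (suc r)) k) →
    coversOrdinary (vmap (punchIn (inject₁ b)) u ∷ʳ inject₁ b) ≡ coversOrdinary u
  coversOrdinary-∷ʳ {r} b u = begin
    allF (suc r) (λ c → occurs (inject₁ c) (u' ∷ʳ y))
      ≡⟨ allF-cong (suc r) (λ c → occurs-∷ʳ (inject₁ c) u' y) ⟩
    allF (suc r) g
      ≡⟨ allF-punchIn r b g ⟩
    (occurs y u' ∨ (y ==F y)) ∧ allF r (g ∘ punchIn b)
      ≡⟨ cong (λ z → (occurs y u' ∨ z) ∧ allF r (g ∘ punchIn b)) (==F-refl y) ⟩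
    (occurs y u' ∨ true) ∧ allF r (g ∘ punchIn b)
      ≡⟨ cong (_∧ allF r (g ∘ punchIn b)) (∨-zeroʳ (occurs y u')) ⟩
    allF r (g ∘ punchIn b)
      ≡⟨ allF-cong r other ⟩
    coversOrdinary u ∎
    where
    y = inject₁ b
    u' = vmap (punchIn y) u
    g : Fin (suc r) → Bool
    g c = occurs (inject₁ c) u' ∨ (y ==F inject₁ c)
    other : ∀ c → g (punchIn b c) ≡ occurs (inject₁ c) u
    other c = begin
      occurs (inject₁ (punchIn b c)) u' ∨ (y ==F inject₁ (punchIn b c))
        ≡⟨ cong (λ z → occurs z u' ∨ (y ==F z)) (inject₁-punchIn b c) ⟩
      occurs (punchIn y (inject₁ c)) u' ∨ (y ==F punchIn y (inject₁ c))
        ≡⟨ cong₂ _∨_ (occurs-punchIn y (inject₁ c) u) (==F-punchInᵢ y (inject₁ c)) ⟩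
      occurs (inject₁ c) u ∨ false
        ≡⟨ ∨-identityʳ _ ⟩
      occurs (inject₁ c) u ∎

  coversPred : ℕ → ℕ → ℕ
  coversPred k zero = 0
  coversPred k (suc r) = covers k r

  ΣV-maxAlone-in : (r k : ℕ) (h : ℕ → Bool) (b : Fin r) →
    ΣV (suc r) k (λ v → ⌜ coversOrdinary (v ∷ʳ inject₁ b) ∧ maxAloneAt r k h (v ∷ʳ inject₁ b) ⌝)
      ≡ ⌜ h (toℕ b) ⌝ * coversPred k r
  ΣV-maxAlone-in (suc r) k h b = begin
    ΣV (suc (suc r)) k (λ v → ⌜ coversOrdinary (v ∷ʳ y) ∧ maxAloneAt (suc r) k h (v ∷ʳ y) ⌝)
      ≡⟨ ΣV-cong (suc (suc r)) k (λ v → cong (λ z → ⌜ coversOrdinary (v ∷ʳ y) ∧ z ⌝) (alone v)) ⟩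
    ΣV (suc (suc r)) k (λ v → ⌜ coversOrdinary (v ∷ʳ y) ∧ (not (occurs y v) ∧ h (toℕ b)) ⌝)
      ≡⟨ ΣV-cong (suc (suc r)) k (λ v → ⌜∧∧⌝ (coversOrdinary (v ∷ʳ y)) (not (occurs y v)) (h (toℕ b))) ⟩
    ΣV (suc (suc r)) k (λ v → ⌜ h (toℕ b) ⌝ * ⌜ coversOrdinary (v ∷ʳ y) ∧ not (occurs y v) ⌝)
      ≡⟨ ΣV-* (suc (suc r)) k ⌜ h (toℕ b) ⌝ _ ⟩
    ⌜ h (toℕ b) ⌝ * ΣV (suc (suc r)) k (λ v → ⌜ coversOrdinary (v ∷ʳ y) ∧ not (occurs y v) ⌝)
      ≡⟨ cong (⌜ h (toℕ b) ⌝ *_) (ΣV-∧-not-occurs (suc r) k y (λ v → coversOrdinary (v ∷ʳ y))) ⟩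
    ⌜ h (toℕ b) ⌝ * ΣV (suc r) k (λ u → ⌜ coversOrdinary (vmap (punchIn y) u ∷ʳ y) ⌝)
      ≡⟨ cong (⌜ h (toℕ b) ⌝ *_) (ΣV-cong (suc r) k (λ u → cong ⌜_⌝ (coversOrdinary-∷ʳ b u))) ⟩
    ⌜ h (toℕ b) ⌝ * ΣV (suc r) k (λ u → ⌜ coversOrdinary u ⌝)
      ≡⟨ cong (⌜ h (toℕ b) ⌝ *_) (ΣV-coversOrdinary k r) ⟩
    ⌜ h (toℕ b) ⌝ * covers k r ∎
    where
    y = inject₁ b
    alone : ∀ v → maxAloneAt (suc r) k h (v ∷ʳ y) ≡ not (occurs y v) ∧ h (toℕ b)
    alone v = begin
      maxAloneAt (suc r) k h (v ∷ʳ y)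
        ≡⟨ maxAloneAt-∷ʳ (suc r) k h v y ⟩
      not (y ==F fromℕ (suc r)) ∧ (not (occurs y v) ∧ h (toℕ y))
        ≡⟨ cong₂ (λ a c → not a ∧ (not (occurs y v) ∧ h c)) (inject₁-==F-fromℕ b) (toℕ-inject₁ b) ⟩
      not (occurs y v) ∧ h (toℕ b) ∎

  ΣV-maxAlone : (r k : ℕ) (h : ℕ → Bool) →
    ΣV (suc r) (suc k) (λ f → ⌜ coversOrdinary f ∧ maxAloneAt r k h f ⌝)
      ≡ ΣF r (λ b → ⌜ h (toℕ b) ⌝ * coversPred k r)
  ΣV-maxAlone r k h = begin
    ΣV (suc r) (suc k) F
      ≡⟨ ΣV-∷ʳ (suc r) k F ⟩
    ΣF (suc r) lastIs
      ≡⟨ ΣF-punchIn r (fromℕ r) lastIs ⟩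
    lastIs (fromℕ r) + ΣF r (lastIs ∘ punchIn (fromℕ r))
      ≡⟨ cong₂ _+_ lastIs-extra (ΣF-cong r (λ b → cong lastIs (punchIn-fromℕ b))) ⟩
    ΣF r (lastIs ∘ inject₁)
      ≡⟨ ΣF-cong r (ΣV-maxAlone-in r k h) ⟩
    ΣF r (λ b → ⌜ h (toℕ b) ⌝ * coversPred k r) ∎
    where
    F : Vec (Fin (suc r)) (suc k) → ℕ
    F f = ⌜ coversOrdinary f ∧ maxAloneAt r k h f ⌝
    lastIs : Fin (suc r) → ℕ
    lastIs y = ΣV (suc r) k (λ v → F (v ∷ʳ y))
    lastIs-extra : lastIs (fromℕ r) ≡ 0
    lastIs-extra = trans (ΣV-cong (suc r) k (λ v → cong (λ z → ⌜ coversOrdinary (v ∷ʳ fromℕ r) ∧ z ⌝)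
        (trans (maxAloneAt-∷ʳ r k h v (fromℕ r))
               (cong (λ z → not z ∧ (not (occurs (fromℕ r) v) ∧ h (toℕ (fromℕ r)))) (==F-refl (fromℕ r))))))
      (trans (ΣV-cong (suc r) k (λ v → cong ⌜_⌝ (∧-zeroʳ (coversOrdinary (v ∷ʳ fromℕ r))))) (ΣV-zero (suc r) k))

  -- Barred arrangements

  module _ {m : ℕ} where

    bars : List (Token m) → List (Token m)
    bars [] = []
    bars (pair ∷ w) = bars w
    bars (bbar i ∷ w) = bbar i ∷ bars w
    bars (rbar i ∷ w) = rbar i ∷ bars w

    nPairs : List (Token m) → ℕ
    nPairs = countᵇ isPair

    canFollow : Token m → List (Token m) → Bool
    canFollow pair w = true
    canFollow (bbar i) w = blueFollowOK (blabel i) w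
    canFollow (rbar i) w = redFollowOK (rlabel i) w

    canFollow-∷ : (ctx t : Token m) (w : List (Token m)) → canFollow ctx (t ∷ w) ≡ canFollow ctx (t ∷ [])
    canFollow-∷ pair t w = refl
    canFollow-∷ (bbar i) pair w = refl
    canFollow-∷ (bbar i) (bbar j) w = refl
    canFollow-∷ (bbar i) (rbar j) w = refl
    canFollow-∷ (rbar i) pair w = refl
    canFollow-∷ (rbar i) (bbar j) w = refl
    canFollow-∷ (rbar i) (rbar j) w = refl

    -- ctx is the token before w; ctx = pair also covers the start of a word, as neither constrains w.
    admissible : (List (Token m) → Bool) → Token m → ℕ → List (Token m) → Bool
    admissible φ ctx c w = (nPairs w ≡ᵇ c) ∧ φ (bars w) ∧ (canFollow ctx w ∧ adjacencyOK w)

    admissible-pair∷ : (φ : List (Token m) → Bool) (ctx : Token m) (c : ℕ) (w : List (Token m)) →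
      admissible φ ctx (suc c) (pair ∷ w) ≡ (canFollow ctx (pair ∷ []) ∧ admissible φ pair c w)
    admissible-pair∷ φ ctx c w =
      trans (cong (λ z → (nPairs w ≡ᵇ c) ∧ φ (bars w) ∧ (z ∧ adjacencyOK w)) (canFollow-∷ ctx pair w))
            (∧-pull (nPairs w ≡ᵇ c) (φ (bars w)) _ (adjacencyOK w))

    admissible-bar∷ : (φ : List (Token m) → Bool) (ctx t : Token m) → isPair t ≡ false →
      (c : ℕ) (w : List (Token m)) →
      admissible φ ctx c (t ∷ w) ≡ (canFollow ctx (t ∷ []) ∧ admissible (λ u → φ (t ∷ u)) t c w)
    admissible-bar∷ φ ctx (bbar i) _ c w =
      trans (cong (λ z → (nPairs w ≡ᵇ c) ∧ φ (bbar i ∷ bars w) ∧ (z ∧ adjacencyOK (bbar i ∷ w)))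
                  (canFollow-∷ ctx (bbar i) w))
            (∧-pull (nPairs w ≡ᵇ c) (φ (bbar i ∷ bars w)) (canFollow ctx (bbar i ∷ [])) (adjacencyOK (bbar i ∷ w)))
    admissible-bar∷ φ ctx (rbar i) _ c w =
      trans (cong (λ z → (nPairs w ≡ᵇ c) ∧ φ (rbar i ∷ bars w) ∧ (z ∧ adjacencyOK (rbar i ∷ w)))
                  (canFollow-∷ ctx (rbar i) w))
            (∧-pull (nPairs w ≡ᵇ c) (φ (rbar i ∷ bars w)) (canFollow ctx (rbar i ∷ [])) (adjacencyOK (rbar i ∷ w)))

    precededByBar-suc : (p q : Bool) (j : ℕ) (w : List (Token m)) →
      pairPrecededByBar p (suc j) w ≡ pairPrecededByBar q (suc j) w
    precededByBar-suc p q j [] = refl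
    precededByBar-suc p q j (pair ∷ w) = refl
    precededByBar-suc p q j (bbar _ ∷ w) = refl
    precededByBar-suc p q j (rbar _ ∷ w) = refl

    precededByBar-after-bar : (c : ℕ) (w : List (Token m)) →
      ((nPairs w ≡ᵇ suc c) ∧ not (pairPrecededByBar true 0 w)) ≡ false
    precededByBar-after-bar c [] = refl
    precededByBar-after-bar c (pair ∷ w) = ∧-zeroʳ _
    precededByBar-after-bar c (bbar _ ∷ w) = precededByBar-after-bar c w
    precededByBar-after-bar c (rbar _ ∷ w) = precededByBar-after-bar c w

    W : ℕ → List (List (Token m))
    W = allWords (allTokens m)

    ΣW-suc : (L : ℕ) (F : List (Token m) → ℕ) →
      ΣL (W (suc L)) F ≡ ΣL (allTokens m) (λ t → ΣL (W L) (λ w → F (t ∷ w)))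
    ΣW-suc L F = trans (ΣL-concatMap (λ t → map (t ∷_) (W L)) (allTokens m) F)
                       (ΣL-cong (allTokens m) (λ t → ΣL-map (t ∷_) (W L) F))

    ΣL-allTokens : (g : Token m → ℕ) → (∀ i → g (bbar i) ≡ 0) → (∀ i → g (rbar i) ≡ 0) →
      ΣL (allTokens m) g ≡ g pair
    ΣL-allTokens g blue red = begin
      g pair + ΣL (map bbar (allFin m) ++ map rbar (allFin (suc m))) g
        ≡⟨ cong (g pair +_) (ΣL-++ (map bbar (allFin m)) _ g) ⟩
      g pair + (ΣL (map bbar (allFin m)) g + ΣL (map rbar (allFin (suc m))) g)
        ≡⟨ cong (g pair +_) (cong₂ _+_ (trans (ΣL-map bbar (allFin m) g) (ΣL-cong (allFin m) blue))
                                       (trans (ΣL-map rbar (allFin (suc m)) g) (ΣL-cong (allFin (suc m)) red))) ⟩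
      g pair + (ΣL (allFin m) (λ _ → 0) + ΣL (allFin (suc m)) (λ _ → 0))
        ≡⟨ cong (g pair +_) (cong₂ _+_ (ΣL-zero (allFin m)) (ΣL-zero (allFin (suc m)))) ⟩
      g pair + 0
        ≡⟨ +-identityʳ (g pair) ⟩
      g pair ∎

    -- Deleting the x-th pair when it is not preceded by a bar (so it follows a pair or starts the word)
    -- is a bijection onto the admissible words with one pair fewer.
    ΣW-unbarredPair : (φ : List (Token m) → Bool) (L c x : ℕ) → x ≤ c →
      ΣL (W (suc L)) (λ w → ⌜ admissible φ pair (suc c) w ∧ not (pairPrecededByBar false x w) ⌝)
        ≡ ΣL (W L) (λ w → ⌜ admissible φ pair c w ⌝)

    ΣW-unbarredPair-0 : (φ : List (Token m) → Bool) (L c : ℕ) →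
      ΣL (W (suc L)) (λ w → ⌜ admissible φ pair (suc c) w ∧ not (pairPrecededByBar false 0 w) ⌝)
        ≡ ΣL (W L) (λ w → ⌜ admissible φ pair c w ⌝)
    ΣW-unbarredPair-0 φ L c =
      trans (ΣW-suc L F)
            (trans (ΣL-allTokens (λ t → ΣL (W L) (λ w → F (t ∷ w)))
                                 (λ i → vanish (bbar i) refl) (λ i → vanish (rbar i) refl))
                   (ΣL-cong (W L) (λ w → cong ⌜_⌝ (∧-identityʳ (admissible φ pair c w)))))
      where
      F : List (Token m) → ℕ
      F w = ⌜ admissible φ pair (suc c) w ∧ not (pairPrecededByBar false 0 w) ⌝
      vanish : (t : Token m) → isPair t ≡ false → ΣL (W L) (λ w → F (t ∷ w)) ≡ 0
      vanish pair ()
      vanish (bbar i) _ = trans (ΣL-cong (W L) (λ w → ⌜∧⌝-absurd (nPairs w ≡ᵇ suc c)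
        (φ (bbar i ∷ bars w) ∧ adjacencyOK (bbar i ∷ w)) (not (pairPrecededByBar true 0 w))
        (precededByBar-after-bar c w))) (ΣL-zero (W L))
      vanish (rbar i) _ = trans (ΣL-cong (W L) (λ w → ⌜∧⌝-absurd (nPairs w ≡ᵇ suc c)
        (φ (rbar i ∷ bars w) ∧ adjacencyOK (rbar i ∷ w)) (not (pairPrecededByBar true 0 w))
        (precededByBar-after-bar c w))) (ΣL-zero (W L))

    ΣW-unbarredPair-suc : (φ : List (Token m) → Bool) (ctx : Token m) (L j c : ℕ) → suc j ≤ c →
      ΣL (W (suc L)) (λ w → ⌜ admissible φ ctx (suc c) w ∧ not (pairPrecededByBar false (suc j) w) ⌝)
        ≡ ΣL (W L) (λ w → ⌜ admissible φ ctx c w ⌝)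
    ΣW-unbarredPair-suc φ ctx zero j (suc c) _ =
      trans (ΣW-suc zero F) (ΣL-allTokens (λ t → F (t ∷ []) + 0) (λ i → refl) (λ i → refl))
      where
      F : List (Token m) → ℕ
      F w = ⌜ admissible φ ctx (suc (suc c)) w ∧ not (pairPrecededByBar false (suc j) w) ⌝
    ΣW-unbarredPair-suc φ ctx (suc L) j (suc c) (s≤s j≤c) =
      trans (ΣW-suc (suc L) _) (trans (ΣL-cong (allTokens m) first) (sym (ΣW-suc L _)))
      where
      factor : (x : Bool) (A q : List (Token m) → Bool) (ws : List (List (Token m))) →
        ΣL ws (λ w → ⌜ (x ∧ A w) ∧ q w ⌝) ≡ ⌜ x ⌝ * ΣL ws (λ w → ⌜ A w ∧ q w ⌝)
      factor x A q ws = trans (ΣL-cong ws (λ w → cong ⌜_⌝ (∧-assoc x (A w) (q w)))) (ΣL-⌜∧⌝ ws x _)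
      barFirst : (t : Token m) → isPair t ≡ false →
        (∀ w → pairPrecededByBar false (suc j) (t ∷ w) ≡ pairPrecededByBar true (suc j) w) →
        ΣL (W (suc L)) (λ w → ⌜ admissible φ ctx (suc (suc c)) (t ∷ w) ∧ not (pairPrecededByBar false (suc j) (t ∷ w)) ⌝)
          ≡ ΣL (W L) (λ w → ⌜ admissible φ ctx (suc c) (t ∷ w) ⌝)
      barFirst t notPair afterBar = begin
        ΣL (W (suc L)) (λ w → ⌜ admissible φ ctx (suc (suc c)) (t ∷ w) ∧ not (pairPrecededByBar false (suc j) (t ∷ w)) ⌝)
          ≡⟨ ΣL-cong (W (suc L)) (λ w → cong₂ (λ a b → ⌜ a ∧ not b ⌝)
                 (admissible-bar∷ φ ctx t notPair (suc (suc c)) w)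
                 (trans (afterBar w) (precededByBar-suc true false j w))) ⟩
        ΣL (W (suc L)) (λ w → ⌜ (x ∧ admissible φ′ t (suc (suc c)) w) ∧ not (pairPrecededByBar false (suc j) w) ⌝)
          ≡⟨ factor x (admissible φ′ t (suc (suc c))) (λ w → not (pairPrecededByBar false (suc j) w)) (W (suc L)) ⟩
        ⌜ x ⌝ * ΣL (W (suc L)) (λ w → ⌜ admissible φ′ t (suc (suc c)) w ∧ not (pairPrecededByBar false (suc j) w) ⌝)
          ≡⟨ cong (⌜ x ⌝ *_) (ΣW-unbarredPair-suc φ′ t L j (suc c) (s≤s j≤c)) ⟩
        ⌜ x ⌝ * ΣL (W L) (λ w → ⌜ admissible φ′ t (suc c) w ⌝)
          ≡⟨ sym (ΣL-⌜∧⌝ (W L) x (admissible φ′ t (suc c))) ⟩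
        ΣL (W L) (λ w → ⌜ x ∧ admissible φ′ t (suc c) w ⌝)
          ≡⟨ ΣL-cong (W L) (λ w → cong ⌜_⌝ (sym (admissible-bar∷ φ ctx t notPair (suc c) w))) ⟩
        ΣL (W L) (λ w → ⌜ admissible φ ctx (suc c) (t ∷ w) ⌝) ∎
        where
        x = canFollow ctx (t ∷ [])
        φ′ = λ u → φ (t ∷ u)

      first : ∀ t →
        ΣL (W (suc L)) (λ w → ⌜ admissible φ ctx (suc (suc c)) (t ∷ w) ∧ not (pairPrecededByBar false (suc j) (t ∷ w)) ⌝)
          ≡ ΣL (W L) (λ w → ⌜ admissible φ ctx (suc c) (t ∷ w) ⌝)
      first pair = begin
        ΣL (W (suc L)) (λ w → ⌜ admissible φ ctx (suc (suc c)) (pair ∷ w) ∧ not (pairPrecededByBar false j w) ⌝)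
          ≡⟨ ΣL-cong (W (suc L)) (λ w → cong (λ z → ⌜ z ∧ not (pairPrecededByBar false j w) ⌝)
                                               (admissible-pair∷ φ ctx (suc c) w)) ⟩
        ΣL (W (suc L)) (λ w → ⌜ (x ∧ admissible φ pair (suc c) w) ∧ not (pairPrecededByBar false j w) ⌝)
          ≡⟨ factor x (admissible φ pair (suc c)) (λ w → not (pairPrecededByBar false j w)) (W (suc L)) ⟩
        ⌜ x ⌝ * ΣL (W (suc L)) (λ w → ⌜ admissible φ pair (suc c) w ∧ not (pairPrecededByBar false j w) ⌝)
          ≡⟨ cong (⌜ x ⌝ *_) (ΣW-unbarredPair φ L c j j≤c) ⟩
        ⌜ x ⌝ * ΣL (W L) (λ w → ⌜ admissible φ pair c w ⌝)
          ≡⟨ sym (ΣL-⌜∧⌝ (W L) x (admissible φ pair c)) ⟩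
        ΣL (W L) (λ w → ⌜ x ∧ admissible φ pair c w ⌝)
          ≡⟨ ΣL-cong (W L) (λ w → cong ⌜_⌝ (sym (admissible-pair∷ φ ctx c w))) ⟩
        ΣL (W L) (λ w → ⌜ admissible φ ctx (suc c) (pair ∷ w) ⌝) ∎
        where
        x = canFollow ctx (pair ∷ [])
      first (bbar i) = barFirst (bbar i) refl (λ w → refl)
      first (rbar i) = barFirst (rbar i) refl (λ w → refl)

    ΣW-unbarredPair φ L c zero _ = ΣW-unbarredPair-0 φ L c
    ΣW-unbarredPair φ L c (suc j) j<c = ΣW-unbarredPair-suc φ pair L j c j<c

    bars-countᵇ : (p : Token m → Bool) → p pair ≡ false → (w : List (Token m)) →
      countᵇ p (bars w) ≡ countᵇ p w
    bars-countᵇ p e [] = refl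
    bars-countᵇ p e (pair ∷ w) rewrite e = bars-countᵇ p e w
    bars-countᵇ p e (bbar i ∷ w) = cong (λ z → if p (bbar i) then suc z else z) (bars-countᵇ p e w)
    bars-countᵇ p e (rbar i ∷ w) = cong (λ z → if p (rbar i) then suc z else z) (bars-countᵇ p e w)

    eachBarOnce : List (Token m) → Bool
    eachBarOnce u = allᵇ (λ i → countᵇ (isBBar i) u ≡ᵇ 1) (allFin m)
                  ∧ allᵇ (λ i → countᵇ (isRBar i) u ≡ᵇ 1) (allFin (suc m))

    arrangementOK-admissible : (r : ℕ) (w : List (Token m)) →
      arrangementOK m r w ≡ admissible eachBarOnce pair (suc r) w
    arrangementOK-admissible r w = cong ((nPairs w ≡ᵇ suc r) ∧_) (begin
      blue w ∧ red w ∧ adjacencyOK w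
        ≡⟨ cong₂ (λ a b → a ∧ b ∧ adjacencyOK w)
             (allᵇ-cong (allFin m) (λ i → cong (_≡ᵇ 1) (sym (bars-countᵇ (isBBar i) refl w))))
             (allᵇ-cong (allFin (suc m)) (λ i → cong (_≡ᵇ 1) (sym (bars-countᵇ (isRBar i) refl w)))) ⟩
      blue (bars w) ∧ red (bars w) ∧ adjacencyOK w
        ≡⟨ sym (∧-assoc (blue (bars w)) (red (bars w)) (adjacencyOK w)) ⟩
      eachBarOnce (bars w) ∧ adjacencyOK w ∎)
      where
      blue red : List (Token m) → Bool
      blue u = allᵇ (λ i → countᵇ (isBBar i) u ≡ᵇ 1) (allFin m)
      red u = allᵇ (λ i → countᵇ (isRBar i) u ≡ᵇ 1) (allFin (suc m))

  arrangementWords : (m r : ℕ) → List (List (Token m))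
  arrangementWords m r = allWords (allTokens m) (suc r + m + suc m)

  nArrangements : ℕ → ℕ → ℕ
  nArrangements m r = ΣL (arrangementWords m r) (λ w → ⌜ arrangementOK m r w ⌝)

  nBarBefore : ℕ → ℕ → ℕ → ℕ
  nBarBefore m r x = ΣL (arrangementWords m r) (λ w → ⌜ arrangementOK m r w ∧ pairPrecededByBar false x w ⌝)

  nBarBefore-suc : (m r x : ℕ) → x ≤ suc r → nBarBefore m (suc r) x + nArrangements m r ≡ nArrangements m (suc r)
  nBarBefore-suc m r x x≤1+r = sym (begin
    nArrangements m (suc r)
      ≡⟨ ΣL-cong ws (λ w → ⌜⌝-split (arrangementOK m (suc r) w) (pairPrecededByBar false x w)) ⟩
    ΣL ws (λ w → ⌜ arrangementOK m (suc r) w ∧ pairPrecededByBar false x w ⌝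
               + ⌜ arrangementOK m (suc r) w ∧ not (pairPrecededByBar false x w) ⌝)
      ≡⟨ ΣL-+ ws _ _ ⟩
    nBarBefore m (suc r) x + ΣL ws (λ w → ⌜ arrangementOK m (suc r) w ∧ not (pairPrecededByBar false x w) ⌝)
      ≡⟨ cong (nBarBefore m (suc r) x +_) (begin
          ΣL ws (λ w → ⌜ arrangementOK m (suc r) w ∧ not (pairPrecededByBar false x w) ⌝)
            ≡⟨ ΣL-cong ws (λ w → cong (λ z → ⌜ z ∧ not (pairPrecededByBar false x w) ⌝)
                                        (arrangementOK-admissible (suc r) w)) ⟩
          ΣL ws (λ w → ⌜ admissible eachBarOnce pair (suc (suc r)) w ∧ not (pairPrecededByBar false x w) ⌝)
            ≡⟨ ΣW-unbarredPair eachBarOnce (suc r + m + suc m) (suc r) x x≤1+r ⟩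
          ΣL (arrangementWords m r) (λ w → ⌜ admissible eachBarOnce pair (suc r) w ⌝)
            ≡⟨ ΣL-cong (arrangementWords m r) (λ w → cong ⌜_⌝ (sym (arrangementOK-admissible r w))) ⟩
          nArrangements m r ∎) ⟩
    nBarBefore m (suc r) x + nArrangements m r ∎)
    where
    ws = arrangementWords m (suc r)

  -- Counting barred Callan sequences

  ΣL-candidates : (m k n r : ℕ) (F : BarredCallan m k n r → ℕ) →
    ΣL (candidates m k n r) F
      ≡ ΣV (suc r) k (λ f → ΣV (suc r) n (λ g → ΣL (arrangementWords m r) (λ w → F (f , g , w))))
  ΣL-candidates m k n r F = begin
    ΣL (concatMap (λ f → concatMap (λ g → map (λ w → f , g , w) ws) gs) Fs) F
      ≡⟨ ΣL-concatMap _ Fs F ⟩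
    ΣL Fs (λ f → ΣL (concatMap (λ g → map (λ w → f , g , w) ws) gs) F)
      ≡⟨ ΣL-cong Fs (λ f → ΣL-concatMap _ gs F) ⟩
    ΣL Fs (λ f → ΣL gs (λ g → ΣL (map (λ w → f , g , w) ws) F))
      ≡⟨ ΣL-cong Fs (λ f → ΣL-cong gs (λ g → ΣL-map (λ w → f , g , w) ws F)) ⟩
    ΣL Fs (λ f → ΣL gs (λ g → ΣL ws (λ w → F (f , g , w))))
      ≡⟨ ΣL-cong Fs (λ f → ΣL-allVecs (suc r) n _) ⟩
    ΣL Fs (λ f → ΣV (suc r) n (λ g → ΣL ws (λ w → F (f , g , w))))
      ≡⟨ ΣL-allVecs (suc r) k _ ⟩
    ΣV (suc r) k (λ f → ΣV (suc r) n (λ g → ΣL ws (λ w → F (f , g , w)))) ∎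
    where
    Fs = allVecs (allFin (suc r)) k
    gs = allVecs (allFin (suc r)) n
    ws = arrangementWords m r

  anyᵇ-lookup : {s k : ℕ} (c : Fin s) (v : Vec (Fin s) k) →
    anyᵇ (λ x → lookup v x ==F c) (allFin k) ≡ occurs c v
  anyᵇ-lookup {s} {k} c v = trans (anyᵇ-tabulate k id _) (anyF-lookup c v)

  callanOK-covers : (k n r : ℕ) (f : Vec (Fin (suc r)) k) (g : Vec (Fin (suc r)) n) →
    callanOK k n r f g ≡ (coversOrdinary f ∧ coversOrdinary g)
  callanOK-covers k n r f g =
    trans (allᵇ-tabulate r id _)
          (trans (allF-cong r (λ b → cong₂ _∧_ (anyᵇ-lookup (inject₁ b) f) (anyᵇ-lookup (inject₁ b) g)))
                 (allF-∧ r _ _))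

  redStarOnly-avoids : (n k m r : ℕ) (c : BarredCallan m k n r) →
    redStarOnly n k m r c ≡ not (occurs (fromℕ r) (proj₁ (proj₂ c)))
  redStarOnly-avoids n k m r (f , g , w) =
    trans (allᵇ-tabulate n id _)
          (trans (allF-lookup (λ a → not (a ==F fromℕ r)) g) (allV-≠ (fromℕ r) g))

  ΣV²-* : (s k n : ℕ) (a : Vec (Fin s) k → ℕ) (b : Vec (Fin s) n → ℕ) (c : ℕ) →
    ΣV s k (λ f → ΣV s n (λ g → a f * (b g * c))) ≡ ΣV s k a * (ΣV s n b * c)
  ΣV²-* s k n a b c =
    trans (ΣV-cong s k (λ f → trans (ΣV-* s n (a f) _) (cong (a f *_) (ΣV-*ʳ s n c b))))
          (ΣV-*ʳ s k (ΣV s n b * c) a)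

  count-C : (m k n r : ℕ) →
    countᵇ (λ c → barredOK m k n r c ∧ true) (candidates m k n r)
      ≡ covers k r * (covers n r * nArrangements m r)
  count-C m k n r = begin
    countᵇ (λ c → barredOK m k n r c ∧ true) (candidates m k n r)
      ≡⟨ countᵇ≡ΣL _ (candidates m k n r) ⟩
    ΣL (candidates m k n r) (λ c → ⌜ barredOK m k n r c ∧ true ⌝)
      ≡⟨ ΣL-candidates m k n r _ ⟩
    ΣV (suc r) k (λ f → ΣV (suc r) n (λ g → ΣL ws (λ w → ⌜ barredOK m k n r (f , g , w) ∧ true ⌝)))
      ≡⟨ ΣV-cong (suc r) k (λ f → ΣV-cong (suc r) n (λ g → separate f g)) ⟩
    ΣV (suc r) k (λ f → ΣV (suc r) n (λ g → ⌜ coversOrdinary f ⌝ * (⌜ coversOrdinary g ⌝ * nArrangements m r)))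
      ≡⟨ ΣV²-* (suc r) k n _ _ (nArrangements m r) ⟩
    ΣV (suc r) k (λ f → ⌜ coversOrdinary f ⌝) * (ΣV (suc r) n (λ g → ⌜ coversOrdinary g ⌝) * nArrangements m r)
      ≡⟨ cong₂ (λ x y → x * (y * nArrangements m r)) (ΣV-coversOrdinary k r) (ΣV-coversOrdinary n r) ⟩
    covers k r * (covers n r * nArrangements m r) ∎
    where
    ws = arrangementWords m r
    separate : ∀ f g → ΣL ws (λ w → ⌜ barredOK m k n r (f , g , w) ∧ true ⌝)
                     ≡ ⌜ coversOrdinary f ⌝ * (⌜ coversOrdinary g ⌝ * nArrangements m r)
    separate f g = begin
      ΣL ws (λ w → ⌜ (callanOK k n r f g ∧ arrangementOK m r w) ∧ true ⌝)
        ≡⟨ ΣL-cong ws (λ w → cong ⌜_⌝ (∧-identityʳ _)) ⟩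
      ΣL ws (λ w → ⌜ callanOK k n r f g ∧ arrangementOK m r w ⌝)
        ≡⟨ ΣL-⌜∧⌝ ws (callanOK k n r f g) (arrangementOK m r) ⟩
      ⌜ callanOK k n r f g ⌝ * nArrangements m r
        ≡⟨ cong (λ z → ⌜ z ⌝ * nArrangements m r) (callanOK-covers k n r f g) ⟩
      ⌜ coversOrdinary f ∧ coversOrdinary g ⌝ * nArrangements m r
        ≡⟨ cong (_* nArrangements m r) (⌜∧⌝ (coversOrdinary f) (coversOrdinary g)) ⟩
      ⌜ coversOrdinary f ⌝ * ⌜ coversOrdinary g ⌝ * nArrangements m r
        ≡⟨ *-assoc ⌜ coversOrdinary f ⌝ _ _ ⟩
      ⌜ coversOrdinary f ⌝ * (⌜ coversOrdinary g ⌝ * nArrangements m r) ∎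

  ΣV-ΣL-maxAlone : (m k r : ℕ) →
    ΣV (suc r) (suc k) (λ f → ΣL (arrangementWords m r) (λ w →
      ⌜ arrangementOK m r w ∧ (coversOrdinary f ∧ maxAloneAt r k (λ x → pairPrecededByBar false x w) f) ⌝))
      ≡ coversPred k r * ΣF r (λ b → nBarBefore m r (toℕ b))
  ΣV-ΣL-maxAlone m k r = begin
    ΣV (suc r) (suc k) (λ f → ΣL ws (λ w → ⌜ arrangementOK m r w ∧ blue w f ⌝))
      ≡⟨ ΣV-ΣL (suc r) (suc k) ws (λ f w → ⌜ arrangementOK m r w ∧ blue w f ⌝) ⟩
    ΣL ws (λ w → ΣV (suc r) (suc k) (λ f → ⌜ arrangementOK m r w ∧ blue w f ⌝))
      ≡⟨ ΣL-cong ws (λ w → trans (ΣV-cong (suc r) (suc k) (λ f → ⌜∧⌝ (arrangementOK m r w) (blue w f)))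
                                 (ΣV-* (suc r) (suc k) ⌜ arrangementOK m r w ⌝ (λ f → ⌜ blue w f ⌝))) ⟩
    ΣL ws (λ w → ⌜ arrangementOK m r w ⌝ * ΣV (suc r) (suc k) (λ f → ⌜ blue w f ⌝))
      ≡⟨ ΣL-cong ws (λ w → cong (⌜ arrangementOK m r w ⌝ *_) (ΣV-maxAlone r k (h w))) ⟩
    ΣL ws (λ w → ⌜ arrangementOK m r w ⌝ * ΣF r (λ b → ⌜ h w (toℕ b) ⌝ * coversPred k r))
      ≡⟨ ΣL-cong ws (λ w → trans (sym (ΣF-* r ⌜ arrangementOK m r w ⌝ _)) (ΣF-cong r (λ b → regroup w b))) ⟩
    ΣL ws (λ w → ΣF r (λ b → coversPred k r * ⌜ arrangementOK m r w ∧ h w (toℕ b) ⌝))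
      ≡⟨ sym (ΣF-ΣL r ws _) ⟩
    ΣF r (λ b → ΣL ws (λ w → coversPred k r * ⌜ arrangementOK m r w ∧ h w (toℕ b) ⌝))
      ≡⟨ ΣF-cong r (λ b → ΣL-* ws (coversPred k r) _) ⟩
    ΣF r (λ b → coversPred k r * nBarBefore m r (toℕ b))
      ≡⟨ ΣF-* r (coversPred k r) _ ⟩
    coversPred k r * ΣF r (λ b → nBarBefore m r (toℕ b)) ∎
    where
    ws = arrangementWords m r
    h : List (Token m) → ℕ → Bool
    h w x = pairPrecededByBar false x w
    blue : List (Token m) → Vec (Fin (suc r)) (suc k) → Bool
    blue w f = coversOrdinary f ∧ maxAloneAt r k (h w) f
    regroup : ∀ w b → ⌜ arrangementOK m r w ⌝ * (⌜ h w (toℕ b) ⌝ * coversPred k r)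
                    ≡ coversPred k r * ⌜ arrangementOK m r w ∧ h w (toℕ b) ⌝
    regroup w b = begin
      ⌜ arrangementOK m r w ⌝ * (⌜ h w (toℕ b) ⌝ * coversPred k r)
        ≡⟨ sym (*-assoc ⌜ arrangementOK m r w ⌝ _ _) ⟩
      ⌜ arrangementOK m r w ⌝ * ⌜ h w (toℕ b) ⌝ * coversPred k r
        ≡⟨ cong (_* coversPred k r) (sym (⌜∧⌝ (arrangementOK m r w) (h w (toℕ b)))) ⟩
      ⌜ arrangementOK m r w ∧ h w (toℕ b) ⌝ * coversPred k r
        ≡⟨ *-comm _ (coversPred k r) ⟩
      coversPred k r * ⌜ arrangementOK m r w ∧ h w (toℕ b) ⌝ ∎

  count-CStarBar : (m k n r : ℕ) →
    countᵇ (λ c → barredOK m (suc k) n r c ∧ (redStarOnly n (suc k) m r c ∧ maxBlueAlone n k m r c))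
           (candidates m (suc k) n r)
      ≡ surj n r * (coversPred k r * ΣF r (λ b → nBarBefore m r (toℕ b)))
  count-CStarBar m k n r = begin
    countᵇ P (candidates m (suc k) n r)
      ≡⟨ countᵇ≡ΣL P (candidates m (suc k) n r) ⟩
    ΣL (candidates m (suc k) n r) (λ c → ⌜ P c ⌝)
      ≡⟨ ΣL-candidates m (suc k) n r _ ⟩
    ΣV (suc r) (suc k) (λ f → ΣV (suc r) n (λ g → ΣL ws (λ w → ⌜ P (f , g , w) ⌝)))
      ≡⟨ ΣV-cong (suc r) (suc k) (λ f → ΣV-cong (suc r) n (λ g → separate f g)) ⟩
    ΣV (suc r) (suc k) (λ f → ΣV (suc r) n (λ g → ⌜ red g ⌝ * X f))
      ≡⟨ ΣV-cong (suc r) (suc k) (λ f → ΣV-*ʳ (suc r) n (X f) (λ g → ⌜ red g ⌝)) ⟩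
    ΣV (suc r) (suc k) (λ f → ΣV (suc r) n (λ g → ⌜ red g ⌝) * X f)
      ≡⟨ ΣV-cong (suc r) (suc k) (λ f → cong (_* X f) (ΣV-coversOrdinary-avoiding-extra n r)) ⟩
    ΣV (suc r) (suc k) (λ f → surj n r * X f)
      ≡⟨ ΣV-* (suc r) (suc k) (surj n r) X ⟩
    surj n r * ΣV (suc r) (suc k) X
      ≡⟨ cong (surj n r *_) (ΣV-ΣL-maxAlone m k r) ⟩
    surj n r * (coversPred k r * ΣF r (λ b → nBarBefore m r (toℕ b))) ∎
    where
    ws = arrangementWords m r
    P : BarredCallan m (suc k) n r → Bool
    P c = barredOK m (suc k) n r c ∧ (redStarOnly n (suc k) m r c ∧ maxBlueAlone n k m r c)
    red : Vec (Fin (suc r)) n → Bool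
    red g = coversOrdinary g ∧ not (occurs (fromℕ r) g)
    blue : List (Token m) → Vec (Fin (suc r)) (suc k) → Bool
    blue w f = coversOrdinary f ∧ maxAloneAt r k (λ x → pairPrecededByBar false x w) f
    X : Vec (Fin (suc r)) (suc k) → ℕ
    X f = ΣL ws (λ w → ⌜ arrangementOK m r w ∧ blue w f ⌝)
    separate : ∀ f g → ΣL ws (λ w → ⌜ P (f , g , w) ⌝) ≡ ⌜ red g ⌝ * X f
    separate f g = trans (ΣL-cong ws (λ w → trans
        (cong₂ (λ a b → ⌜ (a ∧ arrangementOK m r w) ∧ (b ∧ maxBlueAlone n k m r (f , g , w)) ⌝)
               (callanOK-covers (suc k) n r f g) (redStarOnly-avoids n (suc k) m r (f , g , w)))
        (⌜∧⌝-rearrange (coversOrdinary f) (coversOrdinary g) (arrangementOK m r w)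
                       (not (occurs (fromℕ r) g)) (maxBlueAlone n k m r (f , g , w)))))
      (ΣL-* ws ⌜ red g ⌝ _)

  sumℕ-map-cong : (xs : List ℕ) {f g : ℕ → ℕ} → (∀ x → f x ≡ g x) → sumℕ (map f xs) ≡ sumℕ (map g xs)
  sumℕ-map-cong [] e = refl
  sumℕ-map-cong (x ∷ xs) e = cong₂ _+_ (e x) (sumℕ-map-cong xs e)

  cardC-sum : (n k m : ℕ) →
    cardC n k m ≡ sumℕ (map (λ r → covers k r * (covers n r * nArrangements m r)) (upTo (suc k)))
  cardC-sum n k m = sumℕ-map-cong (upTo (suc k)) (count-C m k n)

  nBarBefore-const : (m r x : ℕ) → x ≤ suc r → nBarBefore m (suc r) x ≡ nBarBefore m (suc r) 0
  nBarBefore-const m r x x≤1+r = +-cancelʳ-≡ (nArrangements m r) _ _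
    (trans (nBarBefore-suc m r x x≤1+r) (sym (nBarBefore-suc m r 0 z≤n)))

  coversPred-ΣF-nBarBefore : (m k r : ℕ) →
    coversPred k r * ΣF r (λ b → nBarBefore m r (toℕ b)) ≡ surj (suc k) r * nBarBefore m r 0
  coversPred-ΣF-nBarBefore m k zero = refl
  coversPred-ΣF-nBarBefore m k (suc r) = begin
    covers k r * ΣF (suc r) (λ b → nBarBefore m (suc r) (toℕ b))
      ≡⟨ cong (covers k r *_) (trans (ΣF-cong (suc r) (λ b → nBarBefore-const m r (toℕ b) (toℕ≤n b)))
                                     (ΣF-const (suc r) p)) ⟩
    covers k r * (suc r * p)
      ≡⟨ sym (*-assoc (covers k r) (suc r) p) ⟩
    covers k r * suc r * p
      ≡⟨ cong (_* p) (*-comm (covers k r) (suc r)) ⟩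
    surj (suc k) (suc r) * p ∎
    where
    p = nBarBefore m (suc r) 0

  cardCStarBar-sum : (n k m : ℕ) →
    cardCStarBar n (suc k) m ≡ sumℕ (map (λ r → surj n r * (surj (suc k) r * nBarBefore m r 0)) (upTo (suc (suc k))))
  cardCStarBar-sum n k m = sumℕ-map-cong (upTo (suc (suc k)))
    (λ r → trans (count-CStarBar m k n r) (cong (surj n r *_) (coversPred-ΣF-nBarBefore m k r)))


module AlternatingSums where

  open import Data.Nat as ℕ using (zero; suc; _≤_; z≤n; s≤s)
  import Data.Nat.Properties as ℕ
  open import Data.Integer using (ℤ; +_; -_; _+_; _*_; _-_; -1ℤ; 0ℤ; 1ℤ; _^_)
  open import Data.Integer.Properties using (*-cancelˡ-≡; pos-+; pos-*)
  open import Data.Integer.Tactic.RingSolver using (solve-∀)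
  open import Relation.Binary.PropositionalEquality
  open import Function using (_∘_)
  open ≡-Reasoning
  open Enumeration using (surj)

  alt : (ℕ → ℤ) → ℕ → ℤ
  alt f zero = f 0
  alt f (suc n) = alt f n + (-1ℤ ^ suc n) * f (suc n)

  Σ< : ℕ → (ℕ → ℤ) → ℤ
  Σ< zero f = 0ℤ
  Σ< (suc N) f = Σ< N f + f N

  altSum≡alt : (a : ℕ → ℕ) (n : ℕ) → altSum a n ≡ alt (λ j → + a j) n
  altSum≡alt a zero = refl
  altSum≡alt a (suc n) = cong (_+ (-1ℤ ^ suc n) * + a (suc n)) (altSum≡alt a n)

  alt-cong : (n : ℕ) {f g : ℕ → ℤ} → (∀ j → j ≤ n → f j ≡ g j) → alt f n ≡ alt g n
  alt-cong zero e = e 0 z≤n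
  alt-cong (suc n) e =
    cong₂ _+_ (alt-cong n (λ j j≤n → e j (ℕ.m≤n⇒m≤1+n j≤n))) (cong ((-1ℤ ^ suc n) *_) (e (suc n) ℕ.≤-refl))

  alt-+ : (n : ℕ) (f g : ℕ → ℤ) → alt (λ j → f j + g j) n ≡ alt f n + alt g n
  alt-+ zero f g = refl
  alt-+ (suc n) f g = trans (cong (_+ (-1ℤ ^ suc n) * (f (suc n) + g (suc n))) (alt-+ n f g))
                            (lemma (alt f n) (alt g n) (-1ℤ ^ suc n) (f (suc n)) (g (suc n)))
    where
    lemma : ∀ x y s a b → x + y + s * (a + b) ≡ x + s * a + (y + s * b)
    lemma = solve-∀

  alt-* : (n : ℕ) (c : ℤ) (f : ℕ → ℤ) → alt (λ j → c * f j) n ≡ c * alt f n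
  alt-* zero c f = refl
  alt-* (suc n) c f = trans (cong (_+ (-1ℤ ^ suc n) * (c * f (suc n))) (alt-* n c f))
                            (lemma c (alt f n) (-1ℤ ^ suc n) (f (suc n)))
    where
    lemma : ∀ c x s a → c * x + s * (c * a) ≡ c * (x + s * a)
    lemma = solve-∀

  alt-zero : (n : ℕ) (f : ℕ → ℤ) → (∀ j → j ≤ n → f j ≡ 0ℤ) → alt f n ≡ 0ℤ
  alt-zero zero f e = e 0 z≤n
  alt-zero (suc n) f e =
    trans (cong₂ (λ x y → x + (-1ℤ ^ suc n) * y) (alt-zero n f (λ j j≤n → e j (ℕ.m≤n⇒m≤1+n j≤n)))
                                                  (e (suc n) ℕ.≤-refl))
          (lemma (-1ℤ ^ suc n))
    where
    lemma : ∀ s → 0ℤ + s * 0ℤ ≡ 0ℤ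
    lemma = solve-∀

  alt-suc : (n : ℕ) (f : ℕ → ℤ) → alt f (suc n) ≡ f 0 - alt (f ∘ suc) n
  alt-suc zero f = lemma (f 0) (f 1)
    where
    lemma : ∀ a b → a + (-1ℤ * 1ℤ) * b ≡ a - b
    lemma = solve-∀
  alt-suc (suc n) f =
    trans (cong (_+ (-1ℤ ^ suc (suc n)) * f (suc (suc n))) (alt-suc n f))
          (lemma (f 0) (alt (f ∘ suc) n) (-1ℤ ^ suc n) (f (suc (suc n))))
    where
    lemma : ∀ a x s b → a - x + (-1ℤ * s) * b ≡ a - (x + s * b)
    lemma = solve-∀

  Σ<-cong : (N : ℕ) {f g : ℕ → ℤ} → (∀ r → f r ≡ g r) → Σ< N f ≡ Σ< N g
  Σ<-cong zero e = refl
  Σ<-cong (suc N) e = cong₂ _+_ (Σ<-cong N e) (e N)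

  alt-Σ< : (N n : ℕ) (F : ℕ → ℕ → ℤ) → alt (λ j → Σ< N (F j)) n ≡ Σ< N (λ r → alt (λ j → F j r) n)
  alt-Σ< zero n F = alt-zero n (λ _ → 0ℤ) (λ j _ → refl)
  alt-Σ< (suc N) n F =
    trans (alt-+ n (λ j → Σ< N (F j)) (λ j → F j N)) (cong (_+ alt (λ j → F j N) n) (alt-Σ< N n F))

  Σ<-suc : (N : ℕ) (f : ℕ → ℤ) → Σ< (suc N) f ≡ f 0 + Σ< N (f ∘ suc)
  Σ<-suc zero f = lemma (f 0)
    where
    lemma : ∀ a → 0ℤ + a ≡ a + 0ℤ
    lemma = solve-∀
  Σ<-suc (suc N) f = trans (cong (_+ f (suc N)) (Σ<-suc N f)) (lemma (f 0) (Σ< N (f ∘ suc)) (f (suc N)))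
    where
    lemma : ∀ a b c → a + b + c ≡ a + (b + c)
    lemma = solve-∀

  Σ<-extend : (N d : ℕ) (f : ℕ → ℤ) → (∀ r → N ≤ r → f r ≡ 0ℤ) → Σ< (N ℕ.+ d) f ≡ Σ< N f
  Σ<-extend N zero f e = cong (λ M → Σ< M f) (ℕ.+-identityʳ N)
  Σ<-extend N (suc d) f e = begin
    Σ< (N ℕ.+ suc d) f         ≡⟨ cong (λ M → Σ< M f) (ℕ.+-suc N d) ⟩
    Σ< (N ℕ.+ d) f + f (N ℕ.+ d) ≡⟨ cong₂ _+_ (Σ<-extend N d f e) (e (N ℕ.+ d) (ℕ.m≤m+n N d)) ⟩
    Σ< N f + 0ℤ                  ≡⟨ lemma (Σ< N f) ⟩
    Σ< N f                       ∎
    where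
    lemma : ∀ a → a + 0ℤ ≡ a
    lemma = solve-∀

  Σ<-by-parts : (a d b : ℕ → ℤ) → (∀ r → d (suc r) ≡ a (suc r) - a r) → (N : ℕ) →
    Σ< (suc N) (λ r → a r * (b r - b (suc r)))
      ≡ Σ< (suc N) (λ r → d r * b r) + (a 0 - d 0) * b 0 - a N * b (suc N)
  Σ<-by-parts a d b Δ zero = lemma (a 0) (d 0) (b 0) (b 1)
    where
    lemma : ∀ a d b₀ b₁ → 0ℤ + a * (b₀ - b₁) ≡ 0ℤ + d * b₀ + (a - d) * b₀ - a * b₁
    lemma = solve-∀
  Σ<-by-parts a d b Δ (suc N) = begin
    Σ< (suc N) (λ r → a r * (b r - b (suc r))) + a (suc N) * (b (suc N) - b (suc (suc N)))
      ≡⟨ cong (_+ a (suc N) * (b (suc N) - b (suc (suc N)))) (Σ<-by-parts a d b Δ N) ⟩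
    Σ< (suc N) (λ r → d r * b r) + (a 0 - d 0) * b 0 - a N * b (suc N) + a (suc N) * (b (suc N) - b (suc (suc N)))
      ≡⟨ lemma (Σ< (suc N) (λ r → d r * b r)) ((a 0 - d 0) * b 0) (a N) (a (suc N)) (b (suc N)) (b (suc (suc N))) ⟩
    Σ< (suc N) (λ r → d r * b r) + (a (suc N) - a N) * b (suc N) + (a 0 - d 0) * b 0 - a (suc N) * b (suc (suc N))
      ≡⟨ cong (λ z → Σ< (suc N) (λ r → d r * b r) + z * b (suc N) + (a 0 - d 0) * b 0 - a (suc N) * b (suc (suc N)))
              (sym (Δ N)) ⟩
    Σ< (suc (suc N)) (λ r → d r * b r) + (a 0 - d 0) * b 0 - a (suc N) * b (suc (suc N)) ∎
    where
    lemma : ∀ R c aN aN₁ b₁ b₂ → R + c - aN * b₁ + aN₁ * (b₁ - b₂) ≡ R + (aN₁ - aN) * b₁ + c - aN₁ * b₂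
    lemma = solve-∀

  _⋆_ : (ℕ → ℤ) → (ℕ → ℤ) → ℕ → ℤ
  (u ⋆ v) n = alt (λ j → u j * v (n ∸ j)) n

  shift : (ℕ → ℤ) → ℕ → ℤ
  shift v zero = 0ℤ
  shift v (suc i) = v i

  ⋆-cong : (n : ℕ) {u u′ v v′ : ℕ → ℤ} → (∀ j → u j ≡ u′ j) → (∀ j → v j ≡ v′ j) →
    (u ⋆ v) n ≡ (u′ ⋆ v′) n
  ⋆-cong n eu ev = alt-cong n (λ j _ → cong₂ _*_ (eu j) (ev (n ∸ j)))

  ⋆-shiftʳ : (u v : ℕ → ℤ) (n : ℕ) → (u ⋆ shift v) (suc n) ≡ (u ⋆ v) n
  ⋆-shiftʳ u v n = begin
    alt (λ j → u j * shift v (suc n ∸ j)) n + (-1ℤ ^ suc n) * (u (suc n) * shift v (suc n ∸ suc n))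
      ≡⟨ cong₂ (λ x y → x + (-1ℤ ^ suc n) * (u (suc n) * shift v y))
               (alt-cong n (λ j j≤n → cong (λ i → u j * shift v i) (ℕ.+-∸-assoc 1 j≤n)))
               (ℕ.n∸n≡0 n) ⟩
    (u ⋆ v) n + (-1ℤ ^ suc n) * (u (suc n) * 0ℤ)
      ≡⟨ lemma ((u ⋆ v) n) (-1ℤ ^ suc n) (u (suc n)) ⟩
    (u ⋆ v) n ∎
    where
    lemma : ∀ a s x → a + s * (x * 0ℤ) ≡ a
    lemma = solve-∀

  ⋆-shiftˡ : (u v : ℕ → ℤ) (n : ℕ) → (shift u ⋆ v) (suc n) ≡ - (u ⋆ v) n
  ⋆-shiftˡ u v n = trans (alt-suc n _) (lemma (v (suc n)) ((u ⋆ v) n))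
    where
    lemma : ∀ a b → 0ℤ * a - b ≡ - b
    lemma = solve-∀

  ⋆-+ˡ : (u u′ v : ℕ → ℤ) (n : ℕ) → ((λ j → u j + u′ j) ⋆ v) n ≡ (u ⋆ v) n + (u′ ⋆ v) n
  ⋆-+ˡ u u′ v n = trans (alt-cong n (λ j _ → lemma (u j) (u′ j) (v (n ∸ j)))) (alt-+ n _ _)
    where
    lemma : ∀ a b c → (a + b) * c ≡ a * c + b * c
    lemma = solve-∀

  ⋆-+ʳ : (u v v′ : ℕ → ℤ) (n : ℕ) → (u ⋆ (λ j → v j + v′ j)) n ≡ (u ⋆ v) n + (u ⋆ v′) n
  ⋆-+ʳ u v v′ n = trans (alt-cong n (λ j _ → lemma (u j) (v (n ∸ j)) (v′ (n ∸ j)))) (alt-+ n _ _)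
    where
    lemma : ∀ a b c → a * (b + c) ≡ a * b + a * c
    lemma = solve-∀

  ⋆-*ˡ : (c : ℤ) (u v : ℕ → ℤ) (n : ℕ) → ((λ j → c * u j) ⋆ v) n ≡ c * (u ⋆ v) n
  ⋆-*ˡ c u v n = trans (alt-cong n (λ j _ → lemma c (u j) (v (n ∸ j)))) (alt-* n c _)
    where
    lemma : ∀ c a b → c * a * b ≡ c * (a * b)
    lemma = solve-∀

  ⋆-*ʳ : (c : ℤ) (u v : ℕ → ℤ) (n : ℕ) → (u ⋆ (λ j → c * v j)) n ≡ c * (u ⋆ v) n
  ⋆-*ʳ c u v n = trans (alt-cong n (λ j _ → lemma c (u j) (v (n ∸ j)))) (alt-* n c _)
    where
    lemma : ∀ c a b → a * (c * b) ≡ c * (a * b)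
    lemma = solve-∀

  surjℤ : ℕ → ℕ → ℤ
  surjℤ s j = + surj j s

  coversℤ : ℕ → ℕ → ℤ
  coversℤ r j = surjℤ (suc r) j + surjℤ r j

  surj-< : (j s : ℕ) → j ℕ.< s → surj j s ≡ 0
  surj-< zero (suc s) _ = refl
  surj-< (suc j) (suc s) (s≤s j<s)
    rewrite surj-< j (suc s) (ℕ.m≤n⇒m≤1+n j<s) | surj-< j s j<s = ℕ.*-zeroʳ s

  surjℤ-suc : (s j : ℕ) → surjℤ (suc s) j ≡ + suc s * shift (coversℤ s) j
  surjℤ-suc s zero = lemma (+ suc s)
    where
    lemma : ∀ a → 0ℤ ≡ a * 0ℤ
    lemma = solve-∀
  surjℤ-suc s (suc i) =
    trans (pos-* (suc s) (surj i (suc s) ℕ.+ surj i s)) (cong (+ suc s *_) (pos-+ (surj i (suc s)) (surj i s)))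

  -- Expand (surjℤ (r+1) ⋆ surjℤ (r+1)) (n+1) through the recursion of surj in either factor;
  -- the two expansions differ by the sign of the shifted factor.
  ⋆-surjℤ-cross : (r n : ℕ) →
    (surjℤ r ⋆ surjℤ (suc r)) n + (surjℤ (suc r) ⋆ surjℤ r) n + + 2 * (surjℤ (suc r) ⋆ surjℤ (suc r)) n ≡ 0ℤ
  ⋆-surjℤ-cross r n =
    trans (regroup X Y Z) (trans (cong (_+ (Z + X)) Z+Y≡-[Z+X]) (cancel (Z + X)))
    where
    ρ = + suc r
    X = (surjℤ r ⋆ surjℤ (suc r)) n
    Y = (surjℤ (suc r) ⋆ surjℤ r) n
    Z = (surjℤ (suc r) ⋆ surjℤ (suc r)) n
    viaRight : (surjℤ (suc r) ⋆ surjℤ (suc r)) (suc n) ≡ ρ * (Z + Y)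
    viaRight = begin
      (surjℤ (suc r) ⋆ surjℤ (suc r)) (suc n)
        ≡⟨ ⋆-cong (suc n) {u′ = surjℤ (suc r)} {v′ = λ j → ρ * shift (coversℤ r) j} (λ j → refl) (surjℤ-suc r) ⟩
      (surjℤ (suc r) ⋆ (λ j → ρ * shift (coversℤ r) j)) (suc n)
        ≡⟨ ⋆-*ʳ ρ (surjℤ (suc r)) (shift (coversℤ r)) (suc n) ⟩
      ρ * (surjℤ (suc r) ⋆ shift (coversℤ r)) (suc n)
        ≡⟨ cong (ρ *_) (trans (⋆-shiftʳ (surjℤ (suc r)) (coversℤ r) n)
                              (⋆-+ʳ (surjℤ (suc r)) (surjℤ (suc r)) (surjℤ r) n)) ⟩
      ρ * (Z + Y) ∎
    viaLeft : (surjℤ (suc r) ⋆ surjℤ (suc r)) (suc n) ≡ ρ * - (Z + X)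
    viaLeft = begin
      (surjℤ (suc r) ⋆ surjℤ (suc r)) (suc n)
        ≡⟨ ⋆-cong (suc n) {u′ = λ j → ρ * shift (coversℤ r) j} {v′ = surjℤ (suc r)} (surjℤ-suc r) (λ j → refl) ⟩
      ((λ j → ρ * shift (coversℤ r) j) ⋆ surjℤ (suc r)) (suc n)
        ≡⟨ ⋆-*ˡ ρ (shift (coversℤ r)) (surjℤ (suc r)) (suc n) ⟩
      ρ * (shift (coversℤ r) ⋆ surjℤ (suc r)) (suc n)
        ≡⟨ cong (ρ *_) (trans (⋆-shiftˡ (coversℤ r) (surjℤ (suc r)) n)
                              (cong -_ (⋆-+ˡ (surjℤ (suc r)) (surjℤ r) (surjℤ (suc r)) n))) ⟩
      ρ * - (Z + X) ∎
    Z+Y≡-[Z+X] : Z + Y ≡ - (Z + X)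
    Z+Y≡-[Z+X] = *-cancelˡ-≡ ρ (Z + Y) (- (Z + X)) (trans (sym viaRight) viaLeft)
    regroup : ∀ X Y Z → X + Y + + 2 * Z ≡ (Z + Y) + (Z + X)
    regroup = solve-∀
    cancel : ∀ a → - a + a ≡ 0ℤ
    cancel = solve-∀

  ⋆-coversℤ : (r n : ℕ) →
    (coversℤ r ⋆ coversℤ r) n ≡ (surjℤ r ⋆ surjℤ r) n - (surjℤ (suc r) ⋆ surjℤ (suc r)) n
  ⋆-coversℤ r n = begin
    (coversℤ r ⋆ coversℤ r) n
      ≡⟨ ⋆-+ˡ (surjℤ (suc r)) (surjℤ r) (coversℤ r) n ⟩
    (surjℤ (suc r) ⋆ coversℤ r) n + (surjℤ r ⋆ coversℤ r) n
      ≡⟨ cong₂ _+_ (⋆-+ʳ (surjℤ (suc r)) (surjℤ (suc r)) (surjℤ r) n)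
                   (⋆-+ʳ (surjℤ r) (surjℤ (suc r)) (surjℤ r) n) ⟩
    (Z + Y) + (X + β)
      ≡⟨ regroup X Y Z β ⟩
    (X + Y + + 2 * Z) + (β - Z)
      ≡⟨ cong (_+ (β - Z)) (⋆-surjℤ-cross r n) ⟩
    0ℤ + (β - Z)
      ≡⟨ lemma (β - Z) ⟩
    β - Z ∎
    where
    X = (surjℤ r ⋆ surjℤ (suc r)) n
    Y = (surjℤ (suc r) ⋆ surjℤ r) n
    Z = (surjℤ (suc r) ⋆ surjℤ (suc r)) n
    β = (surjℤ r ⋆ surjℤ r) n
    regroup : ∀ X Y Z β → (Z + Y) + (X + β) ≡ (X + Y + + 2 * Z) + (β - Z)
    regroup = solve-∀
    lemma : ∀ a → 0ℤ + a ≡ a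
    lemma = solve-∀

  ⋆-surjℤ-zero : (n : ℕ) → (surjℤ 0 ⋆ surjℤ 0) (suc n) ≡ 0ℤ
  ⋆-surjℤ-zero n = alt-zero (suc n) _ vanish
    where
    vanish : ∀ j → j ≤ suc n → surjℤ 0 j * surjℤ 0 (suc n ∸ j) ≡ 0ℤ
    vanish zero _ = refl
    vanish (suc j) _ = refl

  ⋆-surjℤ-large : (n : ℕ) → (surjℤ (suc n) ⋆ surjℤ (suc n)) n ≡ 0ℤ
  ⋆-surjℤ-large n = alt-zero n _ vanish
    where
    vanish : ∀ j → j ≤ n → surjℤ (suc n) j * surjℤ (suc n) (n ∸ j) ≡ 0ℤ
    vanish j j≤n rewrite surj-< j (suc n) (s≤s j≤n) = refl

  alternating-identity : (a d : ℕ → ℤ) → (∀ r → d (suc r) ≡ a (suc r) - a r) → (n : ℕ) →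
    alt (λ j → Σ< (suc (suc n)) (λ r → coversℤ r j * (coversℤ r (suc n ∸ j) * a r))) (suc n)
      ≡ alt (λ j → Σ< (suc (suc n)) (λ r → surjℤ r (suc n ∸ j) * (surjℤ r j * d r))) (suc n)
  alternating-identity a d Δ n = begin
    alt (λ j → Σ< (suc N) (λ r → coversℤ r j * (coversℤ r (N ∸ j) * a r))) N
      ≡⟨ alt-Σ< (suc N) N _ ⟩
    Σ< (suc N) (λ r → alt (λ j → coversℤ r j * (coversℤ r (N ∸ j) * a r)) N)
      ≡⟨ Σ<-cong (suc N) telescope ⟩
    Σ< (suc N) (λ r → a r * (β r - β (suc r)))
      ≡⟨ Σ<-by-parts a d β Δ N ⟩
    Σ< (suc N) (λ r → d r * β r) + (a 0 - d 0) * β 0 - a N * β (suc N)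
      ≡⟨ cong₂ (λ x y → Σ< (suc N) (λ r → d r * β r) + (a 0 - d 0) * x - a N * y)
               (⋆-surjℤ-zero n) (⋆-surjℤ-large N) ⟩
    Σ< (suc N) (λ r → d r * β r) + (a 0 - d 0) * 0ℤ - a N * 0ℤ
      ≡⟨ lemma (Σ< (suc N) (λ r → d r * β r)) (a 0 - d 0) (a N) ⟩
    Σ< (suc N) (λ r → d r * β r)
      ≡⟨ Σ<-cong (suc N) (λ r → sym (trans (alt-cong N (λ j _ → reorder (surjℤ r (N ∸ j)) (surjℤ r j) (d r)))
                                            (alt-* N (d r) _))) ⟩
    Σ< (suc N) (λ r → alt (λ j → surjℤ r (N ∸ j) * (surjℤ r j * d r)) N)
      ≡⟨ sym (alt-Σ< (suc N) N _) ⟩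
    alt (λ j → Σ< (suc N) (λ r → surjℤ r (N ∸ j) * (surjℤ r j * d r))) N ∎
    where
    N = suc n
    β : ℕ → ℤ
    β r = (surjℤ r ⋆ surjℤ r) N
    lemma : ∀ x y z → x + y * 0ℤ - z * 0ℤ ≡ x
    lemma = solve-∀
    reorder : ∀ p q d → p * (q * d) ≡ d * (q * p)
    reorder = solve-∀
    regroup : ∀ p q u v w → (p + q) * ((u + v) * w) ≡ w * ((p + q) * (u + v))
    regroup = solve-∀
    telescope : ∀ r → alt (λ j → coversℤ r j * (coversℤ r (N ∸ j) * a r)) N ≡ a r * (β r - β (suc r))
    telescope r = begin
      alt (λ j → coversℤ r j * (coversℤ r (N ∸ j) * a r)) N
        ≡⟨ alt-cong N (λ j _ → regroup (surjℤ (suc r) j) (surjℤ r j)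
                                        (surjℤ (suc r) (N ∸ j)) (surjℤ r (N ∸ j)) (a r)) ⟩
      alt (λ j → a r * (coversℤ r j * coversℤ r (N ∸ j))) N
        ≡⟨ alt-* N (a r) _ ⟩
      a r * (coversℤ r ⋆ coversℤ r) N
        ≡⟨ cong (a r *_) (⋆-coversℤ r N) ⟩
      a r * (β r - β (suc r)) ∎

  Σ<-≤ : (N M : ℕ) (f : ℕ → ℤ) → N ≤ M → (∀ r → N ≤ r → f r ≡ 0ℤ) → Σ< N f ≡ Σ< M f
  Σ<-≤ N M f N≤M e = trans (sym (Σ<-extend N (M ∸ N) f e)) (cong (λ K → Σ< K f) (ℕ.m+[n∸m]≡n N≤M))

module CountsInℤ (m : ℕ) where

  open import Data.Nat as ℕ using (zero; suc; _≤_; z≤n; s≤s)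
  import Data.Nat.Properties as ℕ
  open import Data.Integer using (ℤ; +_; _+_; _*_; _-_; 0ℤ)
  open import Data.Integer.Properties using (pos-+; pos-*; *-zeroʳ)
  open import Data.Integer.Tactic.RingSolver using (solve-∀)
  open import Data.List using (map; upTo; applyUpTo)
  open import Relation.Binary.PropositionalEquality
  open import Function using (_∘_; id)
  open ≡-Reasoning
  open Enumeration using (surj; covers; nArrangements; nBarBefore; nBarBefore-suc; cardC-sum; cardCStarBar-sum)
  open AlternatingSums

  Σ<-applyUpTo : (N : ℕ) (g f : ℕ → ℕ) → + sumℕ (map f (applyUpTo g N)) ≡ Σ< N (λ r → + f (g r))
  Σ<-applyUpTo zero g f = refl
  Σ<-applyUpTo (suc N) g f = begin
    + (f (g 0) ℕ.+ sumℕ (map f (applyUpTo (g ∘ suc) N)))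
      ≡⟨ pos-+ (f (g 0)) _ ⟩
    + f (g 0) + + sumℕ (map f (applyUpTo (g ∘ suc) N))
      ≡⟨ cong (λ z → + f (g 0) + z) (Σ<-applyUpTo N (g ∘ suc) f) ⟩
    + f (g 0) + Σ< N (λ r → + f (g (suc r)))
      ≡⟨ sym (Σ<-suc N (λ r → + f (g r))) ⟩
    Σ< (suc N) (λ r → + f (g r)) ∎

  a : ℕ → ℤ
  a r = + nArrangements m r

  d : ℕ → ℤ
  d zero = 0ℤ
  d (suc r) = + nBarBefore m (suc r) 0

  d≡Δa : ∀ r → d (suc r) ≡ a (suc r) - a r
  d≡Δa r = begin
    + nBarBefore m (suc r) 0
      ≡⟨ lemma (+ nBarBefore m (suc r) 0) (a r) ⟩
    + nBarBefore m (suc r) 0 + a r - a r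
      ≡⟨ cong (_- a r) (sym (pos-+ (nBarBefore m (suc r) 0) (nArrangements m r))) ⟩
    + (nBarBefore m (suc r) 0 ℕ.+ nArrangements m r) - a r
      ≡⟨ cong (λ z → + z - a r) (nBarBefore-suc m r 0 z≤n) ⟩
    a (suc r) - a r ∎
    where
    lemma : ∀ p q → p ≡ p + q - q
    lemma = solve-∀

  cardC-Σ< : (n j : ℕ) → j ≤ n →
    + cardC (n ∸ j) j m ≡ Σ< (suc n) (λ r → coversℤ r j * (coversℤ r (n ∸ j) * a r))
  cardC-Σ< n j j≤n = begin
    + cardC (n ∸ j) j m
      ≡⟨ cong +_ (cardC-sum (n ∸ j) j m) ⟩
    + sumℕ (map (λ r → covers j r ℕ.* (covers (n ∸ j) r ℕ.* nArrangements m r)) (upTo (suc j)))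
      ≡⟨ Σ<-applyUpTo (suc j) id _ ⟩
    Σ< (suc j) (λ r → + (covers j r ℕ.* (covers (n ∸ j) r ℕ.* nArrangements m r)))
      ≡⟨ Σ<-cong (suc j) term ⟩
    Σ< (suc j) F
      ≡⟨ Σ<-≤ (suc j) (suc n) F (s≤s j≤n) vanish ⟩
    Σ< (suc n) F ∎
    where
    F : ℕ → ℤ
    F r = coversℤ r j * (coversℤ r (n ∸ j) * a r)
    +covers : ∀ k r → + covers k r ≡ coversℤ r k
    +covers k r = pos-+ (surj k (suc r)) (surj k r)
    term : ∀ r → + (covers j r ℕ.* (covers (n ∸ j) r ℕ.* nArrangements m r)) ≡ F r
    term r = trans (pos-* (covers j r) _)
      (cong₂ _*_ (+covers j r) (trans (pos-* (covers (n ∸ j) r) _) (cong (_* a r) (+covers (n ∸ j) r))))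
    vanish : ∀ r → suc j ≤ r → F r ≡ 0ℤ
    vanish r j<r rewrite surj-< j (suc r) (ℕ.m≤n⇒m≤1+n j<r) | surj-< j r j<r = refl

  cardCStarBar-Σ< : (n j : ℕ) → j ≤ n →
    + cardCStarBar (n ∸ j) j m ≡ Σ< (suc n) (λ r → surjℤ r (n ∸ j) * (surjℤ r j * d r))
  cardCStarBar-Σ< n zero _ = Σ<-≤ 0 (suc n) _ z≤n vanish
    where
    vanish : ∀ r → 0 ≤ r → surjℤ r n * (surjℤ r 0 * d r) ≡ 0ℤ
    vanish zero _ = *-zeroʳ (surjℤ 0 n)
    vanish (suc r) _ = *-zeroʳ (surjℤ (suc r) n)
  cardCStarBar-Σ< n (suc k) k<n = begin
    + cardCStarBar (n ∸ suc k) (suc k) m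
      ≡⟨ cong +_ (cardCStarBar-sum (n ∸ suc k) k m) ⟩
    + sumℕ (map (λ r → surj (n ∸ suc k) r ℕ.* (surj (suc k) r ℕ.* nBarBefore m r 0)) (upTo (suc (suc k))))
      ≡⟨ Σ<-applyUpTo (suc (suc k)) id _ ⟩
    Σ< (suc (suc k)) (λ r → + (surj (n ∸ suc k) r ℕ.* (surj (suc k) r ℕ.* nBarBefore m r 0)))
      ≡⟨ Σ<-cong (suc (suc k)) term ⟩
    Σ< (suc (suc k)) F
      ≡⟨ Σ<-≤ (suc (suc k)) (suc n) F (s≤s k<n) vanish ⟩
    Σ< (suc n) F ∎
    where
    F : ℕ → ℤ
    F r = surjℤ r (n ∸ suc k) * (surjℤ r (suc k) * d r)
    term : ∀ r → + (surj (n ∸ suc k) r ℕ.* (surj (suc k) r ℕ.* nBarBefore m r 0)) ≡ F r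
    term zero = trans (cong +_ (ℕ.*-zeroʳ (surj (n ∸ suc k) 0))) (sym (*-zeroʳ (surjℤ 0 (n ∸ suc k))))
    term (suc r) = trans (pos-* (surj (n ∸ suc k) (suc r)) _)
      (cong (surjℤ (suc r) (n ∸ suc k) *_) (pos-* (surj (suc k) (suc r)) (nBarBefore m (suc r) 0)))
    vanish : ∀ r → suc (suc k) ≤ r → F r ≡ 0ℤ
    vanish r k<r rewrite surj-< (suc k) r k<r = *-zeroʳ (surjℤ r (n ∸ suc k))

open AlternatingSums using (alt; Σ<; surjℤ; coversℤ; altSum≡alt; alt-cong; alternating-identity)
open import Data.Integer using (+_; _*_)
open CountsInℤ using (cardC-Σ<; cardCStarBar-Σ<; a; d; d≡Δa)
open import Relation.Binary.PropositionalEquality using (sym; module ≡-Reasoning)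
open import Data.Nat using (suc; s≤s)
open ≡-Reasoning

mainTheorem5 : (n m : ℕ) → n ≥ 1 →
    altSum (λ j → cardC (n ∸ j) j m) n ≡ altSum (λ j → cardCStarBar (n ∸ j) j m) n
mainTheorem5 (suc n) m (s≤s _) = begin
  altSum (λ j → cardC (suc n ∸ j) j m) (suc n)
    ≡⟨ altSum≡alt _ (suc n) ⟩
  alt (λ j → + cardC (suc n ∸ j) j m) (suc n)
    ≡⟨ alt-cong (suc n) (cardC-Σ< m (suc n)) ⟩
  alt (λ j → Σ< (suc (suc n)) (λ r → coversℤ r j * (coversℤ r (suc n ∸ j) * a m r))) (suc n)
    ≡⟨ alternating-identity (a m) (d m) (d≡Δa m) n ⟩
  alt (λ j → Σ< (suc (suc n)) (λ r → surjℤ r (suc n ∸ j) * (surjℤ r j * d m r))) (suc n)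
    ≡⟨ sym (alt-cong (suc n) (cardCStarBar-Σ< m (suc n))) ⟩
  alt (λ j → + cardCStarBar (suc n ∸ j) j m) (suc n)
    ≡⟨ sym (altSum≡alt _ (suc n)) ⟩
  altSum (λ j → cardCStarBar (suc n ∸ j) j m) (suc n) ∎
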